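{- For $m,n\ge2$, $\alpha\in\mathcal{C}_{2m}(132)$ with $\{\alpha_1,\dots,\alpha_m\}=\{m+1,\dots,2m\}$ and $\beta\in\mathcal{C}_n(132)$, let $$\alpha\circledast\beta=\bar\alpha_1\cdots\bar\alpha_{m-1}\,\bar\beta_1\cdots\bar\beta_{n-1}\,\bar\alpha_{m+1}\cdots\bar\alpha_{2m}\in S_{n+2m-2},$$ where $\bar\alpha_i=\alpha_i+n-2$ if $i<m$; $\bar\alpha_i=\beta_n+m-1$ if $\alpha_i=m$; $\bar\alpha_i=\alpha_i$ if $i>m$ and $\alpha_i\ne m$; $\bar\beta_i=\beta_i+m-1$ if $\beta_i\ne n$ and $\bar\beta_i=\alpha_m+n-2$ if $\beta_i=n$. Let $A_1=\{4312,3421\}$ and $X_{1,n}=\{\alpha\circledast\beta:\alpha\in A_1,\ \beta\in\mathcal{C}_{n-2}(132)\}$ for $n\ge4$. Recursively, for $k\ge1$ let $$A_k'=\{\alpha\in\mathcal{C}_{2k+2}(132):\{\alpha_1,\dots,\alpha_{k+1}\}=\{k+2,\dots,2k+2\}\},$$ for $k\ge2$ let $A_k=\{\alpha\in A_k':\alpha\notin\bigcup_{j<k}X_{j,2k+2}\}$, and let $X_{k,n}=\{\alpha\circledast\beta:\alpha\in A_k,\ \beta\in\mathcal{C}_{n-2k}(132)\}$ for $n\ge 2k+2$. Then for $k\ge1$ and $n\ge 2k+2$, $|X_{k,n}|=|A_k|\,c_{n-2k}(132)$, where $$|A_k|=|A_k'|-\sum_{i=1}^{k-1}|A_i|\,|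A_{k-i}'|.$$
   Context: $\mathcal{C}_n(132)$ is the set of permutations of $[n]$ in one-line notation that consist of a single $n$-cycle and avoid the pattern $132$; $c_n(132)=|\mathcal{C}_n(132)|$. -}

module Defs where

open import Data.Bool using (Bool; true; false; _∧_; _∨_; not; if_then_else_)
open import Data.Nat using (ℕ; zero; suc; _+_; _*_; _∸_; _≡ᵇ_; _<ᵇ_; _≤ᵇ_; _≟_)
open import Data.List using (List; []; _∷_; _++_; map; filterᵇ; concatMap; take; drop; length; iterate; upTo; deduplicate)
open import Data.Bool.ListAction using (all; any)
import Data.List.Properties as LP
open import Relation.Nullary using (does)

-- A permutation of [n] in one-line notation: the list  α₁ α₂ … αₙ  of values in 1..n.
Perm : Set
Perm = List ℕ

-- 1-indexed entry  αᵢ  (returns 0 outside the range 1..length α; never used there).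
at : List ℕ → ℕ → ℕ
at []       _             = 0
at (x ∷ xs) zero          = 0
at (x ∷ xs) (suc zero)    = x
at (x ∷ xs) (suc (suc i)) = at xs (suc i)

insertions : ℕ → List ℕ → List (List ℕ)
insertions x []       = (x ∷ []) ∷ []
insertions x (y ∷ ys) = (x ∷ y ∷ ys) ∷ map (y ∷_) (insertions x ys)

S : ℕ → List Perm
S zero    = [] ∷ []
S (suc n) = concatMap (insertions (suc n)) (S n)

allDistinct : List ℕ → Bool
allDistinct []       = true
allDistinct (x ∷ xs) = not (any (x ≡ᵇ_) xs) ∧ allDistinct xs

-- α ∈ Sₙ is a single n-cycle iff the cycle of 1, i.e. 1, α(1), …, α^{n-1}(1), has n distinct elements.
isNCycle : ℕ → Perm → Bool
isNCycle n α = allDistinct (iterate (at α) 1 n)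

contains132 : Perm → Bool
contains132 []       = false
contains132 (a ∷ xs) = starting a xs ∨ contains132 xs
  where
  starting : ℕ → List ℕ → Bool
  starting a []       = false
  starting a (b ∷ ys) = (any (λ c → (a <ᵇ c) ∧ (c <ᵇ b)) ys) ∨ starting a ys

avoids132 : Perm → Bool
avoids132 α = not (contains132 α)

C : ℕ → List Perm
C n = filterᵇ (λ α → isNCycle n α ∧ avoids132 α) (S n)

∣_∣ : List Perm → ℕ
∣ xs ∣ = length (deduplicate (LP.≡-dec _≟_) xs)

c : ℕ → ℕ
c n = ∣ C n ∣

star : ℕ → ℕ → Perm → Perm → Perm
star m n α β =
  map (λ a → a + n ∸ 2) (take (m ∸ 1) α)
  ++ map βbar (take (n ∸ 1) β)
  ++ map αbar (drop m α)
  where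
  βbar : ℕ → ℕ
  βbar b = if b ≡ᵇ n then at α m + n ∸ 2 else b + m ∸ 1
  αbar : ℕ → ℕ
  αbar a = if a ≡ᵇ m then at β n + m ∸ 1 else a

range : ℕ → ℕ → List ℕ
range lo hi = map (lo +_) (upTo (suc hi ∸ lo))

sameSet : List ℕ → List ℕ → Bool
sameSet xs ys = all (λ x → any (x ≡ᵇ_) ys) xs ∧ all (λ y → any (y ≡ᵇ_) xs) ys

A′ : ℕ → List Perm
A′ k = filterᵇ (λ α → sameSet (take (suc k) α) (range (k + 2) (2 * k + 2))) (C (2 * k + 2))

memb : Perm → List Perm → Bool
memb σ xs = any (λ τ → does (LP.≡-dec _≟_ σ τ)) xs

mutual
  -- Aₖ (k ≥ 1); A 0 is an unused dummy.
  A : ℕ → List Perm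
  A zero          = []
  A (suc zero)    = (4 ∷ 3 ∷ 1 ∷ 2 ∷ []) ∷ (3 ∷ 4 ∷ 2 ∷ 1 ∷ []) ∷ []
  A (suc (suc k)) =
    filterᵇ (λ α → not (memb α (XU (suc k) (2 * (suc (suc k)) + 2)))) (A′ (suc (suc k)))

  X : ℕ → ℕ → List Perm
  X k N = concatMap (λ α → map (star (suc k) (N ∸ 2 * k) α) (C (N ∸ 2 * k))) (A k)

  XU : ℕ → ℕ → List Perm
  XU zero    N = []
  XU (suc j) N = XU j N ++ X (suc j) N

-- The product α ⊛ β of α ∈ A′ₖ and a 132-avoiding cycle β is again a 132-avoiding cycle, and
-- α and β can be read back from α ⊛ β. Hence X_{k,n} is in bijection with A_k × 𝒞_{n-2k}(132).
-- For the recurrence: for α ∈ A_i and β ∈ 𝒞_{2c+2}(132), α ⊛ β lies in A′_{i+c} exactly when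
-- β ∈ A′_c, so A′_k ∩ X_{i,2k+2} = A_i ⊛ A′_{k-i}. These sets are disjoint for distinct i, since
-- α ⊛ β = α′ ⊛ β′ with α ∈ A_i, α′ ∈ A_{i+d}, d ≥ 1, would factor α′ as α ⊛ γ with
-- γ ∈ 𝒞_{2d+2}(132), putting α′ into X_{i,2(i+d)+2}, which A_{i+d} excludes. Thus A′_k is the
-- disjoint union of A_k and the A_i ⊛ A′_{k-i} for 1 ≤ i < k.

module Submission where

open import Defs

open import Data.Bool using (Bool; true; false; _∧_; _∨_; not; if_then_else_; T)
open import Data.Bool.ListAction using (all; any)
open import Data.Bool.Properties using (not-involutive)
open import Data.Empty using (⊥; ⊥-elim)
open import Data.List using (List; []; _∷_; _++_; map; filterᵇ; concatMap; take; drop; length; iterate; upTo; applyUpTo; deduplicate)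
open import Data.List.Membership.Propositional using (_∈_)
open import Data.List.Membership.Propositional.Properties using (∈-++⁻; ∈-++⁺ˡ; ∈-++⁺ʳ; ∈-map⁻; ∈-map⁺; ∈-upTo⁺; ∈-upTo⁻; ∈-filter⁻; ∈-filter⁺)
import Data.List.Properties as LP
open import Data.List.Properties using (length-++; length-map; length-take; length-drop; length-upTo; length-iterate; filter-all; map-cong)
open import Data.List.Relation.Unary.All as All using (All; []; _∷_)
open import Data.List.Relation.Unary.AllPairs using ([]; _∷_)
open import Data.List.Relation.Unary.Any using (here; there)
open import Data.List.Relation.Unary.Unique.Propositional using (Unique)
import Data.List.Relation.Unary.Unique.Propositional.Properties as UP
open import Data.Nat
open import Data.Nat.ListAction using (sum)
open import Data.Nat.Properties
open import Data.Nat.Tactic.RingSolver using (solve-∀)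
open import Data.List.Membership.DecPropositional Data.Nat._≟_ using (_∈?_)
open import Data.Product using (∃; _×_; _,_; proj₁; proj₂)
open import Data.Sum using (_⊎_; inj₁; inj₂)
open import Data.Unit using (⊤; tt)
open import Function using (_∘_; case_of_)
open import Relation.Binary.Definitions using (tri<; tri≈; tri>)
open import Relation.Binary.PropositionalEquality
open import Relation.Nullary using (¬_; yes; no; does; ¬?)
open import Relation.Nullary.Decidable using (dec-true)

-- 0-indexed, with junk value 0 off the list; `at` from Defs is the 1-indexed variant.
ix : List ℕ → ℕ → ℕ
ix []       _       = 0
ix (x ∷ xs) zero    = x
ix (x ∷ xs) (suc i) = ix xs i

at-suc : ∀ xs i → at xs (suc i) ≡ ix xs i
at-suc []       i       = refl
at-suc (x ∷ xs) zero    = refl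
at-suc (x ∷ xs) (suc i) = at-suc xs i

ix-++ˡ : ∀ xs ys i → i < length xs → ix (xs ++ ys) i ≡ ix xs i
ix-++ˡ (x ∷ xs) ys zero    _         = refl
ix-++ˡ (x ∷ xs) ys (suc i) (s≤s lt) = ix-++ˡ xs ys i lt

ix-++ʳ : ∀ xs ys i → ix (xs ++ ys) (length xs + i) ≡ ix ys i
ix-++ʳ []       ys i = refl
ix-++ʳ (x ∷ xs) ys i = ix-++ʳ xs ys i

ix-map : ∀ f xs i → i < length xs → ix (map f xs) i ≡ f (ix xs i)
ix-map f (x ∷ xs) zero    _        = refl
ix-map f (x ∷ xs) (suc i) (s≤s lt) = ix-map f xs i lt

ix-take : ∀ n xs i → i < n → ix (take n xs) i ≡ ix xs i
ix-take (suc n) []       i       _        = refl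
ix-take (suc n) (x ∷ xs) zero    _        = refl
ix-take (suc n) (x ∷ xs) (suc i) (s≤s lt) = ix-take n xs i lt

ix-drop : ∀ n xs i → ix (drop n xs) i ≡ ix xs (n + i)
ix-drop zero    xs       i = refl
ix-drop (suc n) []       i = refl
ix-drop (suc n) (x ∷ xs) i = ix-drop n xs i

ix-applyUpTo : ∀ (f : ℕ → ℕ) n i → i < n → ix (applyUpTo f n) i ≡ f i
ix-applyUpTo f (suc n) zero    _        = refl
ix-applyUpTo f (suc n) (suc i) (s≤s lt) = ix-applyUpTo (λ k → f (suc k)) n i lt

ix-ext : ∀ xs ys → length xs ≡ length ys → (∀ i → i < length xs → ix xs i ≡ ix ys i) → xs ≡ ys
ix-ext []       []       _  _ = refl
ix-ext (x ∷ xs) (y ∷ ys) eq h =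
  cong₂ _∷_ (h 0 (s≤s z≤n)) (ix-ext xs ys (suc-injective eq) (λ i lt → h (suc i) (s≤s lt)))

∈⇒ix : ∀ {x} xs → x ∈ xs → ∃ λ i → i < length xs × ix xs i ≡ x
∈⇒ix (y ∷ xs) (here refl) = 0 , s≤s z≤n , refl
∈⇒ix (y ∷ xs) (there p) with ∈⇒ix xs p
... | i , lt , eq = suc i , s≤s lt , eq

ix⇒∈ : ∀ xs i → i < length xs → ix xs i ∈ xs
ix⇒∈ (x ∷ xs) zero    _        = here refl
ix⇒∈ (x ∷ xs) (suc i) (s≤s lt) = there (ix⇒∈ xs i lt)

module _ {A B : Set} where

  ∈-concatMap⁻ : ∀ (f : A → List B) {z} ys → z ∈ concatMap f ys → ∃ λ y → y ∈ ys × z ∈ f y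
  ∈-concatMap⁻ f (y ∷ ys) p with ∈-++⁻ (f y) p
  ... | inj₁ q = y , here refl , q
  ... | inj₂ q = let (w , w∈ , r) = ∈-concatMap⁻ f ys q in w , there w∈ , r

  ∈-concatMap⁺ : ∀ (f : A → List B) {z y} ys → y ∈ ys → z ∈ f y → z ∈ concatMap f ys
  ∈-concatMap⁺ f (y ∷ ys) (here refl) q = ∈-++⁺ˡ q
  ∈-concatMap⁺ f (y ∷ ys) (there p)   q = ∈-++⁺ʳ (f y) (∈-concatMap⁺ f ys p q)

  length-concatMap : ∀ (f : A → List B) xs → length (concatMap f xs) ≡ sum (map (λ x → length (f x)) xs)
  length-concatMap f []       = refl
  length-concatMap f (x ∷ xs) = trans (length-++ (f x)) (cong (length (f x) +_) (length-concatMap f xs))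

  Unique-map : (f : A → B) (xs : List A) → Unique xs →
               (∀ {x y} → x ∈ xs → y ∈ xs → f x ≡ f y → x ≡ y) → Unique (map f xs)
  Unique-map f []       _          _ = []
  Unique-map f (x ∷ xs) (nx ∷ uxs) h =
    All.tabulate (λ p q → let (y , y∈ , eq) = ∈-map⁻ f p in All.lookup nx y∈ (h (here refl) (there y∈) (trans q eq)))
    ∷ Unique-map f xs uxs (λ p q → h (there p) (there q))

  Unique-concatMap : (f : A → List B) (xs : List A) → Unique xs →
     (∀ {x} → x ∈ xs → Unique (f x)) →
     (∀ {x y z} → x ∈ xs → y ∈ xs → z ∈ f x → z ∈ f y → x ≡ y) → Unique (concatMap f xs)
  Unique-concatMap f []       _          _  _ = []
  Unique-concatMap f (x ∷ xs) (nx ∷ uxs) hu hd =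
    UP.++⁺ (hu (here refl)) (Unique-concatMap f xs uxs (λ p → hu (there p)) (λ p q → hd (there p) (there q)))
      (λ { (z∈fx , z∈rest) → let (y , y∈ , z∈fy) = ∈-concatMap⁻ f xs z∈rest in
           All.lookup nx y∈ (hd (here refl) (there y∈) z∈fx z∈fy) })

-- Permutations in one-line notation

-- Positions are 0-indexed, values range over 1..N.
record IsPerm (N : ℕ) (σ : List ℕ) : Set where
  field
    len : length σ ≡ N
    rng : ∀ i → i < N → 1 ≤ ix σ i × ix σ i ≤ N
    inj : ∀ i j → i < N → j < N → ix σ i ≡ ix σ j → i ≡ j
    sur : ∀ v → 1 ≤ v → v ≤ N → ∃ λ i → i < N × ix σ i ≡ v
open IsPerm

insertAt : ℕ → ℕ → List ℕ → List ℕ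
insertAt p x τ = take p τ ++ x ∷ drop p τ

∈-insertions⁻ : ∀ {σ} x τ → σ ∈ insertions x τ → ∃ λ p → p ≤ length τ × σ ≡ insertAt p x τ
∈-insertions⁻ x []       (here refl) = 0 , z≤n , refl
∈-insertions⁻ x (y ∷ ys) (here refl) = 0 , z≤n , refl
∈-insertions⁻ x (y ∷ ys) (there q) with ∈-map⁻ (y ∷_) q
... | σ′ , σ′∈ , refl with ∈-insertions⁻ x ys σ′∈
... | p , le , refl = suc p , s≤s le , refl

∈-insertions⁺ : ∀ p x τ → p ≤ length τ → insertAt p x τ ∈ insertions x τ
∈-insertions⁺ zero    x []       _        = here refl
∈-insertions⁺ zero    x (y ∷ ys) _        = here refl
∈-insertions⁺ (suc p) x (y ∷ ys) (s≤s le) = there (∈-map⁺ (y ∷_) (∈-insertions⁺ p x ys le))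

length-insertAt : ∀ p x τ → p ≤ length τ → length (insertAt p x τ) ≡ suc (length τ)
length-insertAt p x τ le = begin
  length (take p τ ++ x ∷ drop p τ) ≡⟨ length-++ (take p τ) ⟩
  length (take p τ) + suc (length (drop p τ)) ≡⟨ cong₂ (λ a b → a + suc b) (length-take p τ) (length-drop p τ) ⟩
  p ⊓ length τ + suc (length τ ∸ p) ≡⟨ cong (_+ suc (length τ ∸ p)) (m≤n⇒m⊓n≡m le) ⟩
  p + suc (length τ ∸ p) ≡⟨ +-suc p _ ⟩
  suc (p + (length τ ∸ p)) ≡⟨ cong suc (m+[n∸m]≡n le) ⟩
  suc (length τ) ∎
  where open ≡-Reasoning

length-take-≤ : ∀ p (τ : List ℕ) → p ≤ length τ → length (take p τ) ≡ p
length-take-≤ p τ le = trans (length-take p τ) (m≤n⇒m⊓n≡m le)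

ix-insertAt-< : ∀ p x τ i → p ≤ length τ → i < p → ix (insertAt p x τ) i ≡ ix τ i
ix-insertAt-< p x τ i le lt = trans (ix-++ˡ (take p τ) _ i (subst (i <_) (sym (length-take-≤ p τ le)) lt)) (ix-take p τ i lt)

ix-insertAt-+ : ∀ p x τ k → p ≤ length τ → ix (insertAt p x τ) (p + k) ≡ ix (x ∷ drop p τ) k
ix-insertAt-+ p x τ k le = subst (λ q → ix (insertAt p x τ) (q + k) ≡ ix (x ∷ drop p τ) k) (length-take-≤ p τ le) (ix-++ʳ (take p τ) _ k)

ix-insertAt-here : ∀ p x τ → p ≤ length τ → ix (insertAt p x τ) p ≡ x
ix-insertAt-here p x τ le = trans (cong (ix (insertAt p x τ)) (sym (+-identityʳ p))) (ix-insertAt-+ p x τ 0 le)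

skip : ℕ → ℕ → ℕ
skip p t with t <? p
... | yes _ = t
... | no  _ = suc t

ix-insertAt-skip : ∀ p x τ t → p ≤ length τ → ix (insertAt p x τ) (skip p t) ≡ ix τ t
ix-insertAt-skip p x τ t le with t <? p
... | yes lt = ix-insertAt-< p x τ t le lt
... | no ¬lt = let pt = ≮⇒≥ ¬lt in begin
  ix (insertAt p x τ) (suc t) ≡⟨ cong (ix (insertAt p x τ)) (trans (cong suc (sym (m+[n∸m]≡n pt))) (sym (+-suc p (t ∸ p)))) ⟩
  ix (insertAt p x τ) (p + suc (t ∸ p)) ≡⟨ ix-insertAt-+ p x τ (suc (t ∸ p)) le ⟩
  ix (drop p τ) (t ∸ p) ≡⟨ ix-drop p τ (t ∸ p) ⟩
  ix τ (p + (t ∸ p)) ≡⟨ cong (ix τ) (m+[n∸m]≡n pt) ⟩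
  ix τ t ∎
  where open ≡-Reasoning

skip≢ : ∀ p t → skip p t ≢ p
skip≢ p t with t <? p
... | yes lt = <⇒≢ lt
... | no ¬lt = λ eq → ¬lt (subst (t <_) eq ≤-refl)

skip-injective : ∀ p t u → skip p t ≡ skip p u → t ≡ u
skip-injective p t u eq with t <? p | u <? p
... | yes _ | yes _ = eq
... | no _  | no _  = suc-injective eq
... | yes a | no b  = ⊥-elim (b (<-trans (≤-reflexive (sym eq)) a))
... | no b  | yes a = ⊥-elim (b (<-trans (≤-reflexive eq) a))

skip-< : ∀ p t n → t < n → skip p t < suc n
skip-< p t n lt with t <? p
... | yes _ = m<n⇒m<1+n lt
... | no  _ = s≤s lt

skip-onto : ∀ p i n → p ≤ n → i < suc n → i ≢ p → ∃ λ t → t < n × skip p t ≡ i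
skip-onto p i n pn lt ne with i <? p
... | yes ip = i , <-≤-trans ip pn , up-lt
  where up-lt : skip p i ≡ i
        up-lt with i <? p
        ... | yes _ = refl
        ... | no q = ⊥-elim (q ip)
... | no ¬ip with i
...   | zero = ⊥-elim (ne (sym (n≤0⇒n≡0 (≮⇒≥ ¬ip))))
...   | suc j = j , j<n , up-eq
  where
  p≤j : p ≤ j
  p≤j with m≤n⇒m<n∨m≡n (≮⇒≥ ¬ip)
  ... | inj₁ (s≤s q) = q
  ... | inj₂ q = ⊥-elim (ne (sym q))
  j<n : j < n
  j<n = ≤-pred lt
  up-eq : skip p j ≡ suc j
  up-eq with j <? p
  ... | yes q = ⊥-elim (<⇒≱ q p≤j)
  ... | no _ = refl

removeAt : ℕ → List ℕ → List ℕ
removeAt p σ = take p σ ++ drop (suc p) σ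

length-removeAt : ∀ p σ → p < length σ → suc (length (removeAt p σ)) ≡ length σ
length-removeAt zero    (y ∷ ys) _        = refl
length-removeAt (suc p) (y ∷ ys) (s≤s lt) = cong suc (length-removeAt p ys lt)

insertAt-removeAt : ∀ p σ → p < length σ → insertAt p (ix σ p) (removeAt p σ) ≡ σ
insertAt-removeAt zero    (y ∷ ys) _        = refl
insertAt-removeAt (suc p) (y ∷ ys) (s≤s lt) = cong (y ∷_) (insertAt-removeAt p ys lt)

insertAt-IsPerm : ∀ n p τ → IsPerm n τ → p ≤ n → IsPerm (suc n) (insertAt p (suc n) τ)
insertAt-IsPerm n p τ P pn = record { len = L ; rng = R ; inj = I ; sur = Su }
  where
  le : p ≤ length τ
  le = subst (p ≤_) (sym (len P)) pn
  σ = insertAt p (suc n) τ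
  L : length σ ≡ suc n
  L = trans (length-insertAt p (suc n) τ le) (cong suc (len P))
  val : ∀ i → i < suc n → (i ≡ p × ix σ i ≡ suc n) ⊎ (∃ λ t → t < n × skip p t ≡ i × ix σ i ≡ ix τ t)
  val i lt with i ≟ p
  ... | yes refl = inj₁ (refl , ix-insertAt-here p (suc n) τ le)
  ... | no ne with skip-onto p i n pn lt ne
  ...   | t , tn , refl = inj₂ (t , tn , refl , ix-insertAt-skip p (suc n) τ t le)
  R : ∀ i → i < suc n → 1 ≤ ix σ i × ix σ i ≤ suc n
  R i lt with val i lt
  ... | inj₁ (_ , e) = subst (λ v → 1 ≤ v × v ≤ suc n) (sym e) (s≤s z≤n , ≤-refl)
  ... | inj₂ (t , tn , _ , e) = subst (λ v → 1 ≤ v × v ≤ suc n) (sym e) (proj₁ (rng P t tn) , m≤n⇒m≤1+n (proj₂ (rng P t tn)))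
  I : ∀ i j → i < suc n → j < suc n → ix σ i ≡ ix σ j → i ≡ j
  I i j li lj e with val i li | val j lj
  ... | inj₁ (a , _) | inj₁ (b , _) = trans a (sym b)
  ... | inj₁ (_ , a) | inj₂ (t , tn , _ , b) = ⊥-elim (<⇒≢ (s≤s (proj₂ (rng P t tn))) (sym (trans (sym a) (trans e b))))
  ... | inj₂ (t , tn , _ , b) | inj₁ (_ , a) = ⊥-elim (<⇒≢ (s≤s (proj₂ (rng P t tn))) (sym (trans (sym a) (trans (sym e) b))))
  ... | inj₂ (t , tn , ut , a) | inj₂ (u , un , uu , b) =
        trans (sym ut) (trans (cong (skip p) (inj P t u tn un (trans (sym a) (trans e b)))) uu)
  Su : ∀ v → 1 ≤ v → v ≤ suc n → ∃ λ i → i < suc n × ix σ i ≡ v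
  Su v v1 vn with v ≟ suc n
  ... | yes refl = p , s≤s pn , ix-insertAt-here p (suc n) τ le
  ... | no ne with sur P v v1 (≤-pred (≤∧≢⇒< vn ne))
  ...   | t , tn , e = skip p t , skip-< p t n tn , trans (ix-insertAt-skip p (suc n) τ t le) e

∈S⇒IsPerm : ∀ N σ → σ ∈ S N → IsPerm N σ
∈S⇒IsPerm zero .[] (here refl) = record { len = refl ; rng = λ i () ; inj = λ i j () ; sur = λ { v (s≤s v1) () } }
∈S⇒IsPerm (suc n) σ m with ∈-concatMap⁻ (insertions (suc n)) (S n) m
... | τ , τ∈ , σ∈ with ∈-insertions⁻ (suc n) τ σ∈
... | p , le , refl = insertAt-IsPerm n p τ P (subst (p ≤_) (len P) le)
  where P = ∈S⇒IsPerm n τ τ∈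

IsPerm⇒∈S : ∀ N σ → IsPerm N σ → σ ∈ S N
IsPerm⇒∈S zero    []      P = here refl
IsPerm⇒∈S zero    (x ∷ σ) P with len P
... | ()
IsPerm⇒∈S (suc n) σ P with sur P (suc n) (s≤s z≤n) ≤-refl
... | p , pn , e = subst (_∈ S (suc n)) eq0 (∈-concatMap⁺ (insertions (suc n)) (S n) (IsPerm⇒∈S n τ Q) (∈-insertions⁺ p (suc n) τ ple))
  where
  τ = removeAt p σ
  pl : p < length σ
  pl = subst (p <_) (sym (len P)) pn
  eq0 : insertAt p (suc n) τ ≡ σ
  eq0 = subst (λ v → insertAt p v τ ≡ σ) e (insertAt-removeAt p σ pl)
  lenτ : length τ ≡ n
  lenτ = suc-injective (trans (length-removeAt p σ pl) (len P))
  ple : p ≤ length τ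
  ple = subst (p ≤_) (sym lenτ) (≤-pred pn)
  ixτ : ∀ t → ix τ t ≡ ix σ (skip p t)
  ixτ t = trans (sym (ix-insertAt-skip p (suc n) τ t ple)) (cong (λ l → ix l (skip p t)) eq0)
  Q : IsPerm n τ
  Q = record { len = lenτ ; rng = R ; inj = I ; sur = Su }
    where
    R : ∀ t → t < n → 1 ≤ ix τ t × ix τ t ≤ n
    R t tn = let (a , b) = rng P (skip p t) (skip-< p t n tn) in
      subst (1 ≤_) (sym (ixτ t)) a ,
      subst (_≤ n) (sym (ixτ t)) (≤-pred (≤∧≢⇒< b (λ q → skip≢ p t (inj P (skip p t) p (skip-< p t n tn) pn (trans q (sym e))))))
    I : ∀ t u → t < n → u < n → ix τ t ≡ ix τ u → t ≡ u
    I t u tn un q = skip-injective p t u (inj P _ _ (skip-< p t n tn) (skip-< p u n un) (trans (sym (ixτ t)) (trans q (ixτ u))))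
    Su : ∀ v → 1 ≤ v → v ≤ n → ∃ λ t → t < n × ix τ t ≡ v
    Su v v1 vn with sur P v v1 (m≤n⇒m≤1+n vn)
    ... | i , il , iv with skip-onto p i n (≤-pred pn) il (λ q → <⇒≢ (s≤s vn) (trans (sym iv) (trans (cong (ix σ) q) e)))
    ...   | t , tn , refl = t , tn , trans (ixτ t) iv

IsPerm-∈ : ∀ {n τ y} → IsPerm n τ → y ∈ τ → 1 ≤ y × y ≤ n
IsPerm-∈ {n} {τ} P y∈ with ∈⇒ix τ y∈
... | i , il , refl = rng P i (subst (i <_) (len P) il)

removeValue : ℕ → List ℕ → List ℕ
removeValue x []       = []
removeValue x (y ∷ ys) with x ≟ y
... | yes _ = ys
... | no  _ = y ∷ removeValue x ys

removeValue-insertions : ∀ {σ} x τ → (∀ {y} → y ∈ τ → y ≢ x) → σ ∈ insertions x τ → removeValue x σ ≡ τ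
removeValue-insertions x []       h (here refl) with x ≟ x
... | yes _ = refl
... | no ne = ⊥-elim (ne refl)
removeValue-insertions x (y ∷ ys) h (here refl) with x ≟ x
... | yes _ = refl
... | no ne = ⊥-elim (ne refl)
removeValue-insertions x (y ∷ ys) h (there q) with ∈-map⁻ (y ∷_) q
... | σ′ , σ′∈ , refl with x ≟ y
... | yes e = ⊥-elim (h (here refl) (sym e))
... | no _ = cong (y ∷_) (removeValue-insertions x ys (λ p → h (there p)) σ′∈)

Unique-insertions : ∀ x τ → (∀ {y} → y ∈ τ → y ≢ x) → Unique (insertions x τ)
Unique-insertions x []       h = [] ∷ []
Unique-insertions x (y ∷ ys) h =
  All.tabulate (λ p q → let (_ , _ , e) = ∈-map⁻ (y ∷_) p in h (here refl) (sym (LP.∷-injectiveˡ (trans q e))))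
  ∷ Unique-map (y ∷_) (insertions x ys) (Unique-insertions x ys (λ p → h (there p))) (λ _ _ e → LP.∷-injectiveʳ e)

Unique-S : ∀ N → Unique (S N)
Unique-S zero    = [] ∷ []
Unique-S (suc n) = Unique-concatMap (insertions (suc n)) (S n) (Unique-S n)
  (λ {τ} τ∈ → Unique-insertions (suc n) τ (λ y∈ e → <⇒≢ (s≤s (proj₂ (IsPerm-∈ (∈S⇒IsPerm n τ τ∈) y∈))) e))
  (λ {τ} {τ′} τ∈ τ′∈ z∈ z∈′ → trans (sym (removeValue-insertions (suc n) τ (h τ∈) z∈)) (removeValue-insertions (suc n) τ′ (h τ′∈) z∈′))
  where
  h : ∀ {τ} → τ ∈ S n → ∀ {y} → y ∈ τ → y ≢ suc n
  h {τ} τ∈ y∈ e = <⇒≢ (s≤s (proj₂ (IsPerm-∈ (∈S⇒IsPerm n τ τ∈) y∈))) e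

Perm-dec = LP.≡-dec _≟_

Unique⇒∣∣≡length : ∀ xs → Unique xs → ∣ xs ∣ ≡ length xs
Unique⇒∣∣≡length xs u = cong length (dd xs u)
  where
  dd : ∀ xs → Unique xs → deduplicate Perm-dec xs ≡ xs
  dd []       _          = refl
  dd (x ∷ xs) (nx ∷ uxs) = cong (x ∷_) (trans (filter-all (λ y → ¬? (Perm-dec x y)) (subst (All (λ y → ¬ x ≡ y)) (sym (dd xs uxs)) nx)) (dd xs uxs))

removeMember : ∀ {A : Set} {x : A} (ys : List A) → x ∈ ys → List A
removeMember (y ∷ ys) (here _)  = ys
removeMember (y ∷ ys) (there p) = y ∷ removeMember ys p

length-removeMember : ∀ {A : Set} {x : A} (ys : List A) (p : x ∈ ys) → suc (length (removeMember ys p)) ≡ length ys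
length-removeMember (y ∷ ys) (here _)  = refl
length-removeMember (y ∷ ys) (there p) = cong suc (length-removeMember ys p)

∈-removeMember : ∀ {A : Set} {x z : A} (ys : List A) (p : x ∈ ys) → z ∈ ys → z ≢ x → z ∈ removeMember ys p
∈-removeMember (y ∷ ys) (here refl) (here refl) ne = ⊥-elim (ne refl)
∈-removeMember (y ∷ ys) (here refl) (there q)   ne = q
∈-removeMember (y ∷ ys) (there p)   (here refl) ne = here refl
∈-removeMember (y ∷ ys) (there p)   (there q)   ne = there (∈-removeMember ys p q ne)

Unique-length-≤ : ∀ {A : Set} (xs ys : List A) → Unique xs → (∀ {z} → z ∈ xs → z ∈ ys) → length xs ≤ length ys
Unique-length-≤ []       ys _          _ = z≤n
Unique-length-≤ (x ∷ xs) ys (nx ∷ uxs) h =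
  let p = h (here refl) in
  subst (suc (length xs) ≤_) (length-removeMember ys p)
    (s≤s (Unique-length-≤ xs (removeMember ys p) uxs (λ {z} z∈ → ∈-removeMember ys p (h (there z∈)) (λ e → All.lookup nx z∈ (sym e)))))

Unique-length-≡ : ∀ {A : Set} (xs ys : List A) → Unique xs → Unique ys → (∀ {z} → z ∈ xs → z ∈ ys) → (∀ {z} → z ∈ ys → z ∈ xs) → length xs ≡ length ys
Unique-length-≡ xs ys ux uy f g = ≤-antisym (Unique-length-≤ xs ys ux f) (Unique-length-≤ ys xs uy g)

length-filterᵇ-not : ∀ {A : Set} (p : A → Bool) xs → length xs ≡ length (filterᵇ p xs) + length (filterᵇ (λ z → not (p z)) xs)
length-filterᵇ-not p []       = refl
length-filterᵇ-not p (x ∷ xs) with p x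
... | true  = cong suc (length-filterᵇ-not p xs)
... | false = trans (cong suc (length-filterᵇ-not p xs)) (sym (+-suc _ _))

module _ {A : Set} (p : A → Bool) where
  any-true⇒ : ∀ xs → any p xs ≡ true → ∃ λ x → x ∈ xs × p x ≡ true
  any-true⇒ (x ∷ xs) e with p x in px
  ... | true  = x , here refl , px
  ... | false = let (y , y∈ , q) = any-true⇒ xs e in y , there y∈ , q

  any-⇒true : ∀ {x} xs → x ∈ xs → p x ≡ true → any p xs ≡ true
  any-⇒true (y ∷ xs) (here refl) e rewrite e = refl
  any-⇒true (y ∷ xs) (there q)   e with p y
  ... | true  = refl
  ... | false = any-⇒true xs q e

  any-⇒false : ∀ xs → (∀ {x} → x ∈ xs → p x ≡ false) → any p xs ≡ false
  any-⇒false []       h = refl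
  any-⇒false (x ∷ xs) h rewrite h (here refl) = any-⇒false xs (λ q → h (there q))

  all-true⇒ : ∀ {x} xs → all p xs ≡ true → x ∈ xs → p x ≡ true
  all-true⇒ (y ∷ xs) e (here refl) with p y
  ... | true = refl
  all-true⇒ (y ∷ xs) e (there q) with p y
  ... | true = all-true⇒ xs e q

  all-⇒true : ∀ xs → (∀ {x} → x ∈ xs → p x ≡ true) → all p xs ≡ true
  all-⇒true []       h = refl
  all-⇒true (x ∷ xs) h rewrite h (here refl) = all-⇒true xs (λ q → h (there q))

true≢false : true ≢ false
true≢false ()

≡ᵇ-true : ∀ m n → (m ≡ᵇ n) ≡ true → m ≡ n
≡ᵇ-true m n e = ≡ᵇ⇒≡ m n (subst T (sym e) tt)

≡ᵇ-refl : ∀ m → (m ≡ᵇ m) ≡ true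
≡ᵇ-refl zero = refl
≡ᵇ-refl (suc m) = ≡ᵇ-refl m

≡ᵇ-false : ∀ m n → m ≢ n → (m ≡ᵇ n) ≡ false
≡ᵇ-false m n ne with m ≡ᵇ n in e
... | false = refl
... | true  = ⊥-elim (ne (≡ᵇ-true m n e))

<ᵇ-true : ∀ m n → (m <ᵇ n) ≡ true → m < n
<ᵇ-true m n e = <ᵇ⇒< m n (subst T (sym e) tt)

<ᵇ-intro : ∀ m n → m < n → (m <ᵇ n) ≡ true
<ᵇ-intro zero    (suc n) _        = refl
<ᵇ-intro (suc m) (suc n) (s≤s lt) = <ᵇ-intro m n lt

≡ᵇ-false⁻ : ∀ {m n} → (m ≡ᵇ n) ≡ false → m ≢ n
≡ᵇ-false⁻ {m} e refl = true≢false (trans (sym (≡ᵇ-refl m)) e)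

∧-true : ∀ a b → a ∧ b ≡ true → a ≡ true × b ≡ true
∧-true true true _ = refl , refl

IndexInjective : List ℕ → Set
IndexInjective xs = ∀ i j → i < length xs → j < length xs → ix xs i ≡ ix xs j → i ≡ j

allDistinct⇒IndexInjective : ∀ xs → allDistinct xs ≡ true → IndexInjective xs
allDistinct⇒IndexInjective (x ∷ xs) e with ∧-true (not (any (x ≡ᵇ_) xs)) _ e
... | a , b = go
  where
  nx : ∀ i → i < length xs → ix xs i ≢ x
  nx i lt q = true≢false (trans (sym (any-⇒true (x ≡ᵇ_) xs (subst (_∈ xs) q (ix⇒∈ xs i lt)) (≡ᵇ-refl x)))
                                (trans (sym (not-involutive _)) (cong not a)))
  go : IndexInjective (x ∷ xs)
  go zero zero _ _ _ = refl
  go zero (suc j) _ (s≤s lj) q = ⊥-elim (nx j lj (sym q))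
  go (suc i) zero (s≤s li) _ q = ⊥-elim (nx i li q)
  go (suc i) (suc j) (s≤s li) (s≤s lj) q = cong suc (allDistinct⇒IndexInjective xs b i j li lj q)

IndexInjective⇒allDistinct : ∀ xs → IndexInjective xs → allDistinct xs ≡ true
IndexInjective⇒allDistinct []       h = refl
IndexInjective⇒allDistinct (x ∷ xs) h = trans (cong (λ c → not c ∧ allDistinct xs) (any-⇒false (x ≡ᵇ_) xs nxs)) (
  IndexInjective⇒allDistinct xs (λ i j li lj q → suc-injective (h (suc i) (suc j) (s≤s li) (s≤s lj) q)))
  where
  nxs : ∀ {y} → y ∈ xs → (x ≡ᵇ y) ≡ false
  nxs {y} y∈ with ∈⇒ix xs y∈
  ... | i , li , refl = ≡ᵇ-false x (ix xs i) (λ q → 0≢1+n (h 0 (suc i) (s≤s z≤n) (s≤s li) q))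

oneTo : ℕ → List ℕ
oneTo N = map suc (upTo N)

length-oneTo : ∀ N → length (oneTo N) ≡ N
length-oneTo N = trans (length-map suc (upTo N)) (length-upTo N)

∈-oneTo⁺ : ∀ {N y} → 1 ≤ y → y ≤ N → y ∈ oneTo N
∈-oneTo⁺ {N} {suc y} _ le = ∈-map⁺ suc (∈-upTo⁺ le)

∈-oneTo⁻ : ∀ {N y} → y ∈ oneTo N → 1 ≤ y × y ≤ N
∈-oneTo⁻ {N} p with ∈-map⁻ suc p
... | z , z∈ , refl = s≤s z≤n , ∈-upTo⁻ z∈

Unique-oneTo : ∀ N → Unique (oneTo N)
Unique-oneTo N = UP.map⁺ suc-injective (UP.upTo⁺ N)

IndexInjective⇒Unique : ∀ xs → IndexInjective xs → Unique xs
IndexInjective⇒Unique []       h = []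
IndexInjective⇒Unique (x ∷ xs) h =
  All.tabulate (λ y∈ e → let (i , li , q) = ∈⇒ix xs y∈ in 0≢1+n (h 0 (suc i) (s≤s z≤n) (s≤s li) (trans e (sym q))))
  ∷ IndexInjective⇒Unique xs (λ i j li lj q → suc-injective (h (suc i) (suc j) (s≤s li) (s≤s lj) q))

pigeonhole : ∀ L N → Unique L → length L ≡ N → (∀ {z} → z ∈ L → 1 ≤ z × z ≤ N) → ∀ y → 1 ≤ y → y ≤ N → y ∈ L
pigeonhole L N uL lL hL y y1 yN with y ∈? L
... | yes p = p
... | no np = ⊥-elim (1+n≰n (subst₂ _≤_ (cong suc lL) (trans (length-removeMember (oneTo N) yr) (length-oneTo N)) (s≤s (Unique-length-≤ L (removeMember (oneTo N) yr) uL sub))))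
  where
  yr = ∈-oneTo⁺ y1 yN
  sub : ∀ {z} → z ∈ L → z ∈ removeMember (oneTo N) yr
  sub {z} z∈ = ∈-removeMember (oneTo N) yr (∈-oneTo⁺ (proj₁ (hL z∈)) (proj₂ (hL z∈))) (λ e → np (subst (_∈ L) e z∈))

IndexInjective-onto : ∀ L N → length L ≡ N → IndexInjective L → (∀ i → i < N → 1 ≤ ix L i × ix L i ≤ N) →
                      ∀ v → 1 ≤ v → v ≤ N → ∃ λ i → i < N × ix L i ≡ v
IndexInjective-onto L N len inj rng v v1 vN =
  let (i , li , e) = ∈⇒ix L (pigeonhole L N (IndexInjective⇒Unique L inj) len bounded v v1 vN)
  in i , subst (i <_) len li , e
  where
  bounded : ∀ {z} → z ∈ L → 1 ≤ z × z ≤ N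
  bounded z∈ = let (i , li , e) = ∈⇒ix L z∈ in subst (λ z → 1 ≤ z × z ≤ N) e (rng i (subst (i <_) len li))

injective⇒IsPerm : ∀ N σ → length σ ≡ N → (∀ i → i < N → 1 ≤ ix σ i × ix σ i ≤ N) →
                   (∀ i j → i < N → j < N → ix σ i ≡ ix σ j → i ≡ j) → IsPerm N σ
injective⇒IsPerm N σ L R I = record
  { len = L ; rng = R ; inj = I
  ; sur = IndexInjective-onto σ N L (λ i j li lj → I i j (subst (i <_) L li) (subst (j <_) L lj)) R }

-- Cycles

iter : (ℕ → ℕ) → ℕ → ℕ → ℕ
iter f zero    x = x
iter f (suc t) x = iter f t (f x)

iter-add : ∀ f a b x → iter f (a + b) x ≡ iter f b (iter f a x)
iter-add f zero    b x = refl
iter-add f (suc a) b x = iter-add f a b (f x)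

iter-suc : ∀ f t x → iter f (suc t) x ≡ f (iter f t x)
iter-suc f t x = trans (cong (λ k → iter f k x) (+-comm 1 t)) (iter-add f t 1 x)

ix-iterate : ∀ f x N t → t < N → ix (iterate f x N) t ≡ iter f t x
ix-iterate f x (suc N) zero    _        = refl
ix-iterate f x (suc N) (suc t) (s≤s lt) = ix-iterate f (f x) N t lt

InRange : ℕ → ℕ → Set
InRange N v = 1 ≤ v × v ≤ N

record IsPermFun (N : ℕ) (f : ℕ → ℕ) : Set where
  field
    fun-range : ∀ v → InRange N v → InRange N (f v)
    fun-injective : ∀ v w → InRange N v → InRange N w → f v ≡ f w → v ≡ w
open IsPermFun public

IsPerm⇒IsPermFun : ∀ {N σ} → IsPerm N σ → IsPermFun N (at σ)
IsPerm⇒IsPermFun {N} {σ} P = record { fun-range = Fr ; fun-injective = Fi }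
  where
  Fr : ∀ v → InRange N v → InRange N (at σ v)
  Fr (suc v) (_ , le) = subst (InRange N) (sym (at-suc σ v)) (rng P v le)
  Fi : ∀ v w → InRange N v → InRange N w → at σ v ≡ at σ w → v ≡ w
  Fi (suc v) (suc w) (_ , lv) (_ , lw) e = cong suc (inj P v w lv lw (trans (sym (at-suc σ v)) (trans e (at-suc σ w))))

OrbitDistinct : ℕ → (ℕ → ℕ) → Set
OrbitDistinct N f = ∀ a b → a < N → b < N → iter f a 1 ≡ iter f b 1 → a ≡ b

isNCycle⇒OrbitDistinct : ∀ N σ → isNCycle N σ ≡ true → OrbitDistinct N (at σ)
isNCycle⇒OrbitDistinct N σ e a b la lb q =
  allDistinct⇒IndexInjective (iterate (at σ) 1 N) e a b (subst (a <_) (sym (length-iterate (at σ) 1 N)) la) (subst (b <_) (sym (length-iterate (at σ) 1 N)) lb)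
    (trans (ix-iterate (at σ) 1 N a la) (trans q (sym (ix-iterate (at σ) 1 N b lb))))

OrbitDistinct⇒IndexInjective : ∀ {N f} → OrbitDistinct N f → IndexInjective (iterate f 1 N)
OrbitDistinct⇒IndexInjective {N} {f} d a b la lb q =
  let la′ = subst (a <_) (length-iterate f 1 N) la ; lb′ = subst (b <_) (length-iterate f 1 N) lb in
  d a b la′ lb′ (trans (sym (ix-iterate f 1 N a la′)) (trans q (ix-iterate f 1 N b lb′)))

OrbitDistinct⇒isNCycle : ∀ N σ → OrbitDistinct N (at σ) → isNCycle N σ ≡ true
OrbitDistinct⇒isNCycle N σ d = IndexInjective⇒allDistinct (iterate (at σ) 1 N) (OrbitDistinct⇒IndexInjective d)

-- A property closed under f that holds at one point of 1..N holds on all of 1..N: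
-- this is the form in which being a single N-cycle is used.
OrbitInduction : ℕ → (ℕ → ℕ) → Set₁
OrbitInduction N f = ∀ (Q : ℕ → Set) → (∀ v → InRange N v → Q v → Q (f v)) → ∀ x → InRange N x → Q x → ∀ y → InRange N y → Q y

module _ {N f} (F : IsPermFun N f) where
  iter-InRange : ∀ t x → InRange N x → InRange N (iter f t x)
  iter-InRange zero    x r = r
  iter-InRange (suc t) x r = iter-InRange t (f x) (fun-range F x r)

  iter-preserves : ∀ (Q : ℕ → Set) → (∀ v → InRange N v → Q v → Q (f v)) → ∀ t x → InRange N x → Q x → Q (iter f t x)
  iter-preserves Q h zero    x r q = q
  iter-preserves Q h (suc t) x r q = iter-preserves Q h t (f x) (fun-range F x r) (h x r q)

  module _ (N1 : 1 ≤ N) (D : OrbitDistinct N f) where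
    orbit-covers : ∀ y → InRange N y → ∃ λ t → t < N × iter f t 1 ≡ y
    orbit-covers y ry =
      let (t , t<N , e) = IndexInjective-onto (iterate f 1 N) N (length-iterate f 1 N) (OrbitDistinct⇒IndexInjective D)
                            inRange y (proj₁ ry) (proj₂ ry)
      in t , t<N , trans (sym (ix-iterate f 1 N t t<N)) e
      where
      inRange : ∀ i → i < N → InRange N (ix (iterate f 1 N) i)
      inRange i i<N = subst (InRange N) (sym (ix-iterate f 1 N i i<N)) (iter-InRange i 1 (≤-refl , N1))

    iter-period : iter f N 1 ≡ 1
    iter-period with orbit-covers (iter f N 1) (iter-InRange N 1 (≤-refl , N1))
    ... | zero  , _  , e = sym e
    ... | suc i , li , e = ⊥-elim (n≮n N′ (≤-pred (subst₂ (λ a b → suc (suc a) ≤ b) iN NN li)))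
      where
      N′ = pred N
      NN : N ≡ suc N′
      NN = sym (suc-pred N ⦃ >-nonZero N1 ⦄)
      e′ : f (iter f i 1) ≡ f (iter f N′ 1)
      e′ = trans (sym (iter-suc f i 1)) (trans e (trans (cong (λ k → iter f k 1) NN) (iter-suc f N′ 1)))
      iN : i ≡ N′
      iN = D i N′ (<-trans (n<1+n i) li) (subst (N′ <_) (sym NN) (n<1+n N′))
             (fun-injective F _ _ (iter-InRange i 1 (≤-refl , N1)) (iter-InRange N′ 1 (≤-refl , N1)) e′)

    orbitInduction : OrbitInduction N f
    orbitInduction Q h x rx qx y ry =
      let (i , li , ei) = orbit-covers x rx ; (s , ls , es) = orbit-covers y ry
          back : iter f (N ∸ i) x ≡ 1
          back = trans (cong (iter f (N ∸ i)) (sym ei)) (trans (sym (iter-add f i (N ∸ i) 1)) (trans (cong (λ k → iter f k 1) (m+[n∸m]≡n (<⇒≤ li))) iter-period))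
          q1 : Q 1
          q1 = subst Q back (iter-preserves Q h (N ∸ i) x rx qx)
      in subst Q es (iter-preserves Q h s 1 (≤-refl , N1) q1)

isNCycle⇒OrbitInduction : ∀ {N σ} → IsPerm N σ → isNCycle N σ ≡ true → 1 ≤ N → OrbitInduction N (at σ)
isNCycle⇒OrbitInduction {N} {σ} P c N1 = orbitInduction (IsPerm⇒IsPermFun P) N1 (isNCycle⇒OrbitDistinct N σ c)

reachable-no-repeat : ∀ {N f} → (∀ y → InRange N y → ∃ λ t → iter f t 1 ≡ y) → ∀ a b → a < b → b < N → iter f a 1 ≡ iter f b 1 → ⊥
reachable-no-repeat {N} {f} R a b ab bN e = n≮n b (<-≤-trans bN (subst (_≤ b) (length-oneTo N) (subst (length (oneTo N) ≤_) (length-iterate f 1 b) (Unique-length-≤ (oneTo N) (iterate f 1 b) (Unique-oneTo N) sub))))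
    where
    red : ∀ k t → t < k → ∃ λ u → u < b × iter f t 1 ≡ iter f u 1
    red (suc k) t lt with t <? b
    ... | yes tb = t , tb , refl
    ... | no ¬tb = let bt = ≮⇒≥ ¬tb
                       (u , ub , q) = red k (a + (t ∸ b)) (≤-trans (+-monoˡ-< (t ∸ b) ab) (≤-trans (≤-reflexive (m+[n∸m]≡n bt)) (≤-pred lt)))
                   in u , ub , trans (trans (cong (λ z → iter f z 1) (sym (m+[n∸m]≡n bt))) (trans (iter-add f b (t ∸ b) 1) (trans (cong (iter f (t ∸ b)) (sym e)) (sym (iter-add f a (t ∸ b) 1))))) q
    sub : ∀ {z} → z ∈ oneTo N → z ∈ iterate f 1 b
    sub z∈ = let (t , et) = R _ (∈-oneTo⁻ z∈) ; (u , ub , q) = red (suc t) t ≤-refl in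
      subst (_∈ iterate f 1 b) (trans (ix-iterate f 1 b u ub) (trans (sym q) et))
        (ix⇒∈ (iterate f 1 b) u (subst (u <_) (sym (length-iterate f 1 b)) ub))

reachable⇒OrbitDistinct : ∀ {N f} → (∀ y → InRange N y → ∃ λ t → iter f t 1 ≡ y) → OrbitDistinct N f
reachable⇒OrbitDistinct {N} {f} R a b la lb e with <-cmp a b
... | tri≈ _ q _ = q
... | tri< a<b _ _ = ⊥-elim (reachable-no-repeat R a b a<b lb e)
... | tri> _ _ b<a = ⊥-elim (reachable-no-repeat R b a b<a la (sym e))

reachable⇒isNCycle : ∀ N σ → (∀ (y : ℕ) → InRange N y → ∃ λ t → iter (at σ) t 1 ≡ y) → isNCycle N σ ≡ true
reachable⇒isNCycle N σ R = OrbitDistinct⇒isNCycle N σ (reachable⇒OrbitDistinct R)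

∨-introˡ : ∀ a b → a ≡ true → a ∨ b ≡ true
∨-introˡ true b _ = refl
∨-introʳ : ∀ a b → b ≡ true → a ∨ b ≡ true
∨-introʳ true  b _ = refl
∨-introʳ false b e = e
∨-elim : ∀ a b → a ∨ b ≡ true → a ≡ true ⊎ b ≡ true
∨-elim true  b _ = inj₁ refl
∨-elim false b e = inj₂ e
∧-intro : ∀ a b → a ≡ true → b ≡ true → a ∧ b ≡ true
∧-intro true true _ _ = refl

-- The pattern 132

starts132 : ℕ → List ℕ → Bool
starts132 a []       = false
starts132 a (b ∷ ys) = any (λ c → (a <ᵇ c) ∧ (c <ᵇ b)) ys ∨ starts132 a ys

contains132′ : List ℕ → Bool
contains132′ []       = false
contains132′ (a ∷ xs) = starts132 a xs ∨ contains132′ xs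

-- `starts132` copies the helper local to `contains132`, which can only be reached through
-- unification; hence the abstraction over g.
contains132-unfold : (g : ℕ → List ℕ → Bool) → (∀ a xs → contains132 (a ∷ xs) ≡ (g a xs ∨ contains132 xs)) → (∀ a → g a [] ≡ false) →
   (∀ a b ys → g a (b ∷ ys) ≡ (any (λ c → (a <ᵇ c) ∧ (c <ᵇ b)) ys ∨ g a ys)) → ∀ σ → contains132 σ ≡ contains132′ σ
contains132-unfold g h0 h1 h2 [] = refl
contains132-unfold g h0 h1 h2 (a ∷ xs) = trans (h0 a xs) (cong₂ _∨_ (gst a xs) (contains132-unfold g h0 h1 h2 xs))
  where
  gst : ∀ a xs → g a xs ≡ starts132 a xs
  gst a []       = h1 a
  gst a (b ∷ ys) = trans (h2 a b ys) (cong (any (λ c → (a <ᵇ c) ∧ (c <ᵇ b)) ys ∨_) (gst a ys))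

contains132≗contains132′ : ∀ σ → contains132 σ ≡ contains132′ σ
contains132≗contains132′ = contains132-unfold _ (λ a xs → refl) (λ a → refl) (λ a b ys → refl)

Has132 : List ℕ → Set
Has132 σ = ∃ λ i → ∃ λ j → ∃ λ k → i < j × j < k × k < length σ × ix σ i < ix σ k × ix σ k < ix σ j

Starts132 : ℕ → List ℕ → Set
Starts132 a xs = ∃ λ j → ∃ λ k → j < k × k < length xs × a < ix xs k × ix xs k < ix xs j

starts132⇒ : ∀ a xs → starts132 a xs ≡ true → Starts132 a xs
starts132⇒ a (b ∷ ys) e with ∨-elim (any (λ c → (a <ᵇ c) ∧ (c <ᵇ b)) ys) _ e
... | inj₂ e2 = let (j , k , jk , kl , p , q) = starts132⇒ a ys e2 in suc j , suc k , s≤s jk , s≤s kl , p , q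
... | inj₁ e1 with any-true⇒ (λ c → (a <ᵇ c) ∧ (c <ᵇ b)) ys e1
...   | c , c∈ , pc with ∈⇒ix ys c∈ | ∧-true (a <ᵇ c) (c <ᵇ b) pc
...     | k , kl , refl | p1 , p2 = 0 , suc k , s≤s z≤n , s≤s kl , <ᵇ-true _ _ p1 , <ᵇ-true _ _ p2

⇒starts132 : ∀ a xs → Starts132 a xs → starts132 a xs ≡ true
⇒starts132 a (b ∷ ys) (zero , suc k , _ , s≤s kl , p , q) =
  ∨-introˡ _ _ (any-⇒true (λ c → (a <ᵇ c) ∧ (c <ᵇ b)) ys (ix⇒∈ ys k kl) (∧-intro _ _ (<ᵇ-intro _ _ p) (<ᵇ-intro _ _ q)))
⇒starts132 a (b ∷ ys) (suc j , suc k , s≤s jk , s≤s kl , p , q) = ∨-introʳ _ _ (⇒starts132 a ys (j , k , jk , kl , p , q))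

contains132⇒ : ∀ σ → contains132′ σ ≡ true → Has132 σ
contains132⇒ (a ∷ xs) e with ∨-elim (starts132 a xs) _ e
... | inj₁ e1 = let (j , k , jk , kl , p , q) = starts132⇒ a xs e1 in 0 , suc j , suc k , s≤s z≤n , s≤s jk , s≤s kl , p , q
... | inj₂ e2 = let (i , j , k , ij , jk , kl , p , q) = contains132⇒ xs e2 in suc i , suc j , suc k , s≤s ij , s≤s jk , s≤s kl , p , q

⇒contains132 : ∀ σ → Has132 σ → contains132′ σ ≡ true
⇒contains132 (a ∷ xs) (zero , suc j , suc k , _ , s≤s jk , s≤s kl , p , q) = ∨-introˡ _ _ (⇒starts132 a xs (j , k , jk , kl , p , q))
⇒contains132 (a ∷ xs) (suc i , suc j , suc k , s≤s ij , s≤s jk , s≤s kl , p , q) = ∨-introʳ _ _ (⇒contains132 xs (i , j , k , ij , jk , kl , p , q))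

Avoids132 : List ℕ → Set
Avoids132 σ = ∀ i j k → i < j → j < k → k < length σ → ix σ i < ix σ k → ix σ k < ix σ j → ⊥

avoids132⇒Avoids132 : ∀ σ → avoids132 σ ≡ true → Avoids132 σ
avoids132⇒Avoids132 σ e i j k ij jk kl p q =
  true≢false (trans (sym e) (cong not (trans (contains132≗contains132′ σ) (⇒contains132 σ (i , j , k , ij , jk , kl , p , q)))))

Avoids132⇒avoids132 : ∀ σ → Avoids132 σ → avoids132 σ ≡ true
Avoids132⇒avoids132 σ h with contains132 σ in e
... | false = refl
... | true  = let (i , j , k , ij , jk , kl , p , q) = contains132⇒ σ (trans (sym (contains132≗contains132′ σ)) e) in ⊥-elim (h i j k ij jk kl p q)

T→≡ : ∀ {b} → T b → b ≡ true
T→≡ {true} _ = refl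
≡→T : ∀ {b} → b ≡ true → T b
≡→T refl = tt

∈-filterᵇ⁻ : ∀ {A : Set} (p : A → Bool) {x} xs → x ∈ filterᵇ p xs → x ∈ xs × p x ≡ true
∈-filterᵇ⁻ p xs m = let (a , b) = ∈-filter⁻ (λ x → Data.Bool.T? (p x)) {xs = xs} m in a , T→≡ b

∈-filterᵇ⁺ : ∀ {A : Set} (p : A → Bool) {x} xs → x ∈ xs → p x ≡ true → x ∈ filterᵇ p xs
∈-filterᵇ⁺ p xs m e = ∈-filter⁺ (λ x → Data.Bool.T? (p x)) m (≡→T e)

∈C⁻ : ∀ {N α} → α ∈ C N → IsPerm N α × isNCycle N α ≡ true × avoids132 α ≡ true
∈C⁻ {N} {α} m = let (a , b) = ∈-filterᵇ⁻ (λ α → isNCycle N α ∧ avoids132 α) (S N) m ; (c , d) = ∧-true _ _ b in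
  ∈S⇒IsPerm N α a , c , d

∈C⁺ : ∀ {N α} → IsPerm N α → isNCycle N α ≡ true → avoids132 α ≡ true → α ∈ C N
∈C⁺ {N} {α} P c d = ∈-filterᵇ⁺ (λ α → isNCycle N α ∧ avoids132 α) (S N) (IsPerm⇒∈S N α P) (∧-intro _ _ c d)

Unique-C : ∀ N → Unique (C N)
Unique-C N = UP.filter⁺ _ (Unique-S N)

sameSet⁻ : ∀ xs ys → sameSet xs ys ≡ true → (∀ {x} → x ∈ xs → x ∈ ys) × (∀ {y} → y ∈ ys → y ∈ xs)
sameSet⁻ xs ys e = let (a , b) = ∧-true _ _ e in
  (λ {x} x∈ → mem x ys (all-true⇒ (λ x → any (x ≡ᵇ_) ys) xs a x∈)) ,
  (λ {y} y∈ → mem y xs (all-true⇒ (λ y → any (y ≡ᵇ_) xs) ys b y∈))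
  where
  mem : ∀ x zs → any (x ≡ᵇ_) zs ≡ true → x ∈ zs
  mem x zs e = let (z , z∈ , q) = any-true⇒ (x ≡ᵇ_) zs e in subst (_∈ zs) (sym (≡ᵇ-true x z q)) z∈

sameSet⁺ : ∀ xs ys → (∀ {x} → x ∈ xs → x ∈ ys) → (∀ {y} → y ∈ ys → y ∈ xs) → sameSet xs ys ≡ true
sameSet⁺ xs ys f g = ∧-intro _ _
  (all-⇒true (λ x → any (x ≡ᵇ_) ys) xs (λ {x} x∈ → any-⇒true (x ≡ᵇ_) ys (f x∈) (≡ᵇ-refl x)))
  (all-⇒true (λ y → any (y ≡ᵇ_) xs) ys (λ {y} y∈ → any-⇒true (y ≡ᵇ_) xs (g y∈) (≡ᵇ-refl y)))

∈-range⁻ : ∀ {lo hi y} → y ∈ range lo hi → lo ≤ y × y ≤ hi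
∈-range⁻ {lo} {hi} m with ∈-map⁻ (lo +_) m
... | z , z∈ , refl = m≤m+n lo z , lem
  where
  lt = ∈-upTo⁻ z∈
  lem : lo + z ≤ hi
  lem with lo ≤? suc hi
  ... | yes le = ≤-pred (subst (suc (lo + z) ≤_) (m+[n∸m]≡n le) (+-monoʳ-< lo lt))
  ... | no nle = ⊥-elim (n≮0 (subst (z <_) (m≤n⇒m∸n≡0 (<⇒≤ (≰⇒> nle))) lt))

∈-range⁺ : ∀ {lo hi y} → lo ≤ y → y ≤ hi → y ∈ range lo hi
∈-range⁺ {lo} {hi} {y} ly yh = subst (_∈ range lo hi) (m+[n∸m]≡n ly) (∈-map⁺ (lo +_) (∈-upTo⁺ (∸-monoˡ-< (s≤s yh) ly)))

-- For a permutation of 1..2h this says {α₁,…,α_h} = {h+1,…,2h}, the condition defining A′_{h-1}.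
HighThenLow : ℕ → List ℕ → Set
HighThenLow h σ = (∀ i → i < h → h < ix σ i) × (∀ i → h ≤ i → i < h + h → ix σ i ≤ h)

2k+2≡ : ∀ k → 2 * k + 2 ≡ suc k + suc k
2k+2≡ k = trans (+-comm (2 * k) 2) (cong suc (trans (cong (λ z → suc (k + z)) (+-identityʳ k)) (sym (+-suc k k))))

k+2 : ∀ k → k + 2 ≡ suc (suc k)
k+2 k = +-comm k 2

ix-∈-take : ∀ h σ i → i < h → h ≤ length σ → ix σ i ∈ take h σ
ix-∈-take h σ i ih hl = subst (_∈ take h σ) (ix-take h σ i ih) (ix⇒∈ (take h σ) i (subst (i <_) (sym (length-take-≤ h σ hl)) ih))

∈-take⇒ix : ∀ h σ {x} → x ∈ take h σ → h ≤ length σ → ∃ λ i → i < h × ix σ i ≡ x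
∈-take⇒ix h σ m hl = let (i , li , e) = ∈⇒ix (take h σ) m ; li′ = subst (i <_) (length-take-≤ h σ hl) li in
  i , li′ , trans (sym (ix-take h σ i li′)) e

∈A′⁻ : ∀ k α → α ∈ A′ k → α ∈ C (2 * k + 2) × HighThenLow (suc k) α
∈A′⁻ k α m = a , pre , tl
  where
  ab = ∈-filterᵇ⁻ (λ α → sameSet (take (suc k) α) (range (k + 2) (2 * k + 2))) (C (2 * k + 2)) m
  a = proj₁ ab
  fg = sameSet⁻ _ _ (proj₂ ab)
  f = proj₁ fg
  g = proj₂ fg
  P = proj₁ (∈C⁻ a)
  L : length α ≡ suc k + suc k
  L = trans (len P) (2k+2≡ k)
  hl : suc k ≤ length α
  hl = subst (suc k ≤_) (sym L) (m≤m+n (suc k) (suc k))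
  pre : ∀ i → i < suc k → suc k < ix α i
  pre i li = subst (_≤ ix α i) (k+2 k) (proj₁ (∈-range⁻ (f (ix-∈-take (suc k) α i li hl))))
  tl : ∀ i → suc k ≤ i → i < suc k + suc k → ix α i ≤ suc k
  tl i ki il with ix α i ≤? suc k
  ... | yes q = q
  ... | no q = ⊥-elim (<⇒≱ li′ (subst (suc k ≤_) (sym (inj P i′ i (subst (i′ <_) (sym (2k+2≡ k)) (≤-trans li′ (m≤m+n (suc k) (suc k)))) iN e)) ki))
    where
    iN = subst (i <_) (sym (2k+2≡ k)) il
    r2 = proj₂ (rng P i iN)
    t = ∈-take⇒ix (suc k) α (g (∈-range⁺ (subst (_≤ ix α i) (sym (k+2 k)) (≰⇒> q)) r2)) hl
    i′ = proj₁ t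
    li′ = proj₁ (proj₂ t)
    e = proj₂ (proj₂ t)

∈A′⁺ : ∀ k α → α ∈ C (2 * k + 2) → HighThenLow (suc k) α → α ∈ A′ k
∈A′⁺ k α m (pre , tl) = ∈-filterᵇ⁺ (λ α → sameSet (take (suc k) α) (range (k + 2) (2 * k + 2))) (C (2 * k + 2)) m
   (sameSet⁺ _ _ f g)
  where
  P = proj₁ (∈C⁻ m)
  L : length α ≡ suc k + suc k
  L = trans (len P) (2k+2≡ k)
  hl : suc k ≤ length α
  hl = subst (suc k ≤_) (sym L) (m≤m+n (suc k) (suc k))
  f : ∀ {x} → x ∈ take (suc k) α → x ∈ range (k + 2) (2 * k + 2)
  f x∈ = let (i , li , e) = ∈-take⇒ix (suc k) α x∈ hl
             iN = subst (i <_) (sym (2k+2≡ k)) (≤-trans li (m≤m+n (suc k) (suc k)))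
         in subst (_∈ range (k + 2) (2 * k + 2)) e (∈-range⁺ (subst (_≤ ix α i) (sym (k+2 k)) (pre i li)) (proj₂ (rng P i iN)))
  g : ∀ {y} → y ∈ range (k + 2) (2 * k + 2) → y ∈ take (suc k) α
  g {y} y∈ = let (a , b) = ∈-range⁻ y∈
                 a′ = subst (_≤ y) (k+2 k) a
                 (i , li , e) = sur P y (≤-trans (s≤s z≤n) a′) b
             in subst (_∈ take (suc k) α) e (ix-∈-take (suc k) α i (ilt i li e a′) hl)
    where
    ilt : ∀ i → i < 2 * k + 2 → ix α i ≡ y → suc (suc k) ≤ y → i < suc k
    ilt i li e a′ with i <? suc k
    ... | yes q = q
    ... | no q = ⊥-elim (<⇒≱ a′ (subst (_≤ suc k) e (tl i (≮⇒≥ q) (subst (i <_) (2k+2≡ k) li))))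

record Cycle132 (n : ℕ) (β : List ℕ) : Set where
  field
    P : IsPerm n β
    cy : isNCycle n β ≡ true
    av : Avoids132 β

∈C⇒Cycle132 : ∀ {n β} → β ∈ C n → Cycle132 n β
∈C⇒Cycle132 {n} {β} m = let (P , c , v) = ∈C⁻ m in record { P = P ; cy = c ; av = avoids132⇒Avoids132 β v }

last≢length : ∀ b β → Cycle132 (suc (suc b)) β → ix β (suc b) ≢ suc (suc b)
last≢length b β cf e = Qn (suc (suc b)) (s≤s z≤n , ≤-refl) refl
  where
  open Cycle132 cf
  F = IsPerm⇒IsPermFun P
  Q : ℕ → Set
  Q v = v ≢ suc (suc b)
  cl : ∀ v → InRange (suc (suc b)) v → Q v → Q (at β v)
  cl v rv qv e′ = qv (fun-injective F v (suc (suc b)) rv (s≤s z≤n , ≤-refl) (trans e′ (sym (trans (at-suc β (suc b)) e))))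
  Qn = isNCycle⇒OrbitInduction P cy (s≤s z≤n) Q cl 1 (≤-refl , s≤s z≤n) (λ ())

record InA′ (k : ℕ) (α : List ℕ) : Set where
  field
    P : IsPerm (suc k + suc k) α
    H : HighThenLow (suc k) α
    cy : isNCycle (suc k + suc k) α ≡ true
    av : Avoids132 α

∈A′⇒InA′ : ∀ {k α} → α ∈ A′ k → InA′ k α
∈A′⇒InA′ {k} {α} m = let (c , h) = ∈A′⁻ k α m ; cf = ∈C⇒Cycle132 c in
  record { P = subst (λ z → IsPerm z α) (2k+2≡ k) (Cycle132.P cf) ; H = h ; cy = subst (λ z → isNCycle z α ≡ true) (2k+2≡ k) (Cycle132.cy cf) ; av = Cycle132.av cf }

InA′⇒∈A′ : ∀ k α → InA′ k α → α ∈ A′ k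
InA′⇒∈A′ k α f = ∈A′⁺ k α (∈C⁺ (subst (λ z → IsPerm z α) (sym (2k+2≡ k)) (InA′.P f)) (subst (λ z → isNCycle z α ≡ true) (sym (2k+2≡ k)) (InA′.cy f)) (Avoids132⇒avoids132 α (InA′.av f))) (InA′.H f)

InA′⇒Cycle132 : ∀ {c β} → InA′ c β → Cycle132 (suc (suc (c + c))) β
InA′⇒Cycle132 {c} {β} f = record
  { P = subst (λ z → IsPerm z β) (cong suc (+-suc c c)) (InA′.P f)
  ; cy = subst (λ z → isNCycle z β ≡ true) (cong suc (+-suc c c)) (InA′.cy f)
  ; av = InA′.av f }

Cycle132⇒∈C : ∀ {n β} → Cycle132 n β → β ∈ C n
Cycle132⇒∈C {n} {β} f = ∈C⁺ (Cycle132.P f) (Cycle132.cy f) (Avoids132⇒avoids132 β (Cycle132.av f))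

-- The product α ⊛ β

βbar : ℕ → ℕ → List ℕ → List ℕ → ℕ → ℕ
βbar m n α β b = if b ≡ᵇ n then at α m + n ∸ 2 else b + m ∸ 1

αbar : ℕ → ℕ → List ℕ → List ℕ → ℕ → ℕ
αbar m n α β a = if a ≡ᵇ m then at β n + m ∸ 1 else a

star-unfold : ∀ m n α β → star m n α β ≡
  map (λ a → a + n ∸ 2) (take (m ∸ 1) α) ++ map (βbar m n α β) (take (n ∸ 1) β) ++ map (αbar m n α β) (drop m α)
star-unfold m n α β = refl

+2∸2 : ∀ x b → x + suc (suc b) ∸ 2 ≡ x + b
+2∸2 x b = cong (_∸ 2) (trans (+-suc x (suc b)) (cong suc (+-suc x b)))

+1∸1 : ∀ y a → y + suc a ∸ 1 ≡ y + a
+1∸1 y a = cong (_∸ 1) (+-suc y a)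

-- With m = a + 1 and n = b + 2, α ⊛ β consists of the blocks α₁…α_a raised by b, then
-- β₁…β_{n-1} raised by a with n replaced by α_m + b, then α_{m+1}…α_{2m} with m replaced by
-- β_n + a. Its entries fall into the bands Hi (above a + b + 1), Mi (a + 1 … a + b + 1) and Lo (1 … a).
module Star (a b : ℕ) (α β : List ℕ) (Lα : length α ≡ suc a + suc a) (Lβ : length β ≡ suc (suc b)) where
  m = suc a
  n = suc (suc b)
  N = a + suc b + suc a
  σ = star m n α β
  αm = ix α a
  βn = ix β (suc b)
  βb : ℕ → ℕ
  βb y = if y ≡ᵇ n then αm + b else y + a
  αb : ℕ → ℕ
  αb x = if x ≡ᵇ m then βn + a else x

  βb-eq : ∀ y → βbar m n α β y ≡ βb y
  βb-eq y with y ≡ᵇ n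
  ... | true  = trans (+2∸2 (at α m) b) (cong (_+ b) (at-suc α a))
  ... | false = +1∸1 y a

  αb-eq : ∀ x → αbar m n α β x ≡ αb x
  αb-eq x with x ≡ᵇ m
  ... | true  = trans (+1∸1 (at β n) a) (cong (_+ a) (at-suc β (suc b)))
  ... | false = refl

  PL = map (λ x → x + n ∸ 2) (take a α)
  BL = map (βbar m n α β) (take (suc b) β)
  TL = map (αbar m n α β) (drop m α)

  σ-eq : σ ≡ PL ++ BL ++ TL
  σ-eq = star-unfold m n α β

  lenPL : length PL ≡ a
  lenPL = trans (length-map _ (take a α)) (length-take-≤ a α (subst (a ≤_) (sym Lα) (≤-trans (n≤1+n a) (m≤m+n (suc a) (suc a)))))
  lenBL : length BL ≡ suc b
  lenBL = trans (length-map _ (take (suc b) β)) (length-take-≤ (suc b) β (subst (suc b ≤_) (sym Lβ) (n≤1+n (suc b))))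
  lenTL : length TL ≡ suc a
  lenTL = trans (length-map _ (drop m α)) (trans (length-drop m α) (trans (cong (_∸ m) Lα) (m+n∸m≡n m m)))

  lenσ : length σ ≡ N
  lenσ = trans (cong length σ-eq) (trans (length-++ PL) (trans (cong (length PL +_) (length-++ BL))
           (trans (cong₂ _+_ lenPL (cong₂ _+_ lenBL lenTL)) (sym (+-assoc a (suc b) (suc a))))))

  ixP : ∀ i → i < a → ix σ i ≡ ix α i + b
  ixP i lt = begin
    ix σ i ≡⟨ cong (λ l → ix l i) σ-eq ⟩
    ix (PL ++ BL ++ TL) i ≡⟨ ix-++ˡ PL _ i (subst (i <_) (sym lenPL) lt) ⟩
    ix PL i ≡⟨ ix-map _ (take a α) i (subst (i <_) (sym (trans (sym (length-map (λ x → x + n ∸ 2) (take a α))) lenPL)) lt) ⟩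
    ix (take a α) i + n ∸ 2 ≡⟨ +2∸2 _ b ⟩
    ix (take a α) i + b ≡⟨ cong (_+ b) (ix-take a α i lt) ⟩
    ix α i + b ∎
    where open ≡-Reasoning

  ixB : ∀ q → q < suc b → ix σ (a + q) ≡ βb (ix β q)
  ixB q lt = begin
    ix σ (a + q) ≡⟨ cong (λ l → ix l (a + q)) σ-eq ⟩
    ix (PL ++ BL ++ TL) (a + q) ≡⟨ cong (λ z → ix (PL ++ BL ++ TL) (z + q)) (sym lenPL) ⟩
    ix (PL ++ BL ++ TL) (length PL + q) ≡⟨ ix-++ʳ PL _ q ⟩
    ix (BL ++ TL) q ≡⟨ ix-++ˡ BL _ q (subst (q <_) (sym lenBL) lt) ⟩
    ix BL q ≡⟨ ix-map _ (take (suc b) β) q (subst (q <_) (sym (trans (sym (length-map (βbar m n α β) (take (suc b) β))) lenBL)) lt) ⟩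
    βbar m n α β (ix (take (suc b) β) q) ≡⟨ βb-eq (ix (take (suc b) β) q) ⟩
    βb (ix (take (suc b) β) q) ≡⟨ cong βb (ix-take (suc b) β q lt) ⟩
    βb (ix β q) ∎
    where open ≡-Reasoning

  ixT : ∀ r → r < suc a → ix σ (a + suc b + r) ≡ αb (ix α (m + r))
  ixT r lt = begin
    ix σ (a + suc b + r) ≡⟨ cong (λ l → ix l (a + suc b + r)) σ-eq ⟩
    ix (PL ++ BL ++ TL) (a + suc b + r) ≡⟨ cong (ix (PL ++ BL ++ TL)) (trans (+-assoc a (suc b) r) (cong₂ (λ u v → u + (v + r)) (sym lenPL) (sym lenBL))) ⟩
    ix (PL ++ BL ++ TL) (length PL + (length BL + r)) ≡⟨ ix-++ʳ PL _ _ ⟩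
    ix (BL ++ TL) (length BL + r) ≡⟨ ix-++ʳ BL _ r ⟩
    ix TL r ≡⟨ ix-map _ (drop m α) r (subst (r <_) (sym (trans (sym (length-map (αbar m n α β) (drop m α))) lenTL)) lt) ⟩
    αbar m n α β (ix (drop m α) r) ≡⟨ αb-eq (ix (drop m α) r) ⟩
    αb (ix (drop m α) r) ≡⟨ cong αb (ix-drop m α r) ⟩
    αb (ix α (m + r)) ∎
    where open ≡-Reasoning

  data Cls (i : ℕ) : Set where
    cP : ∀ p → p < a → i ≡ p → Cls i
    cB : ∀ q → q < suc b → i ≡ a + q → Cls i
    cT : ∀ r → r < suc a → i ≡ a + suc b + r → Cls i

  cls : ∀ i → i < N → Cls i
  cls i lt with i <? a
  ... | yes p = cP i p refl
  ... | no ¬p with i <? a + suc b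
  ...   | yes q = cB (i ∸ a) (subst (i ∸ a <_) (m+n∸m≡n a (suc b)) (∸-monoˡ-< q (≮⇒≥ ¬p))) (sym (m+[n∸m]≡n (≮⇒≥ ¬p)))
  ...   | no ¬q = cT (i ∸ (a + suc b)) (subst (i ∸ (a + suc b) <_) (m+n∸m≡n (a + suc b) (suc a)) (∸-monoˡ-< lt (≮⇒≥ ¬q))) (sym (m+[n∸m]≡n (≮⇒≥ ¬q)))

  open IsPerm
  module Entries (Pα : IsPerm (suc a + suc a) α) (Hα : HighThenLow (suc a) α) (Pβ : IsPerm (suc (suc b)) β) (βn≢ : ix β (suc b) ≢ suc (suc b)) where

    αPre : ∀ p → p < suc a → suc a < ix α p × ix α p ≤ suc a + suc a
    αPre p lt = proj₁ Hα p lt , proj₂ (rng Pα p (≤-trans lt (m≤m+n (suc a) (suc a))))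

    αTl : ∀ r → r < suc a → 1 ≤ ix α (m + r) × ix α (m + r) ≤ suc a
    αTl r lt = proj₁ (rng Pα (m + r) (+-monoʳ-< m lt)) , proj₂ Hα (m + r) (m≤m+n m r) (+-monoʳ-< m lt)

    βR : ∀ q → q < n → 1 ≤ ix β q × ix β q ≤ n
    βR q lt = rng Pβ q lt

    βM : ∀ q → q < n → ix β q ≢ n → 1 ≤ ix β q × ix β q ≤ suc b
    βM q lt ne = proj₁ (βR q lt) , ≤-pred (≤∧≢⇒< (proj₂ (βR q lt)) ne)

    βnM : 1 ≤ βn × βn ≤ suc b
    βnM = βM (suc b) ≤-refl βn≢

    vB : ∀ q → q < suc b → (ix β q ≡ n × ix σ (a + q) ≡ αm + b) ⊎ (ix β q ≢ n × ix σ (a + q) ≡ ix β q + a)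
    vB q lt with ix β q ≡ᵇ n in e
    ... | true  = inj₁ (≡ᵇ-true _ _ e , trans (ixB q lt) (cong (λ c → if c then αm + b else ix β q + a) e))
    ... | false = inj₂ (≡ᵇ-false⁻ e , trans (ixB q lt) (cong (λ c → if c then αm + b else ix β q + a) e))

    vT : ∀ r → r < suc a → (ix α (m + r) ≡ m × ix σ (a + suc b + r) ≡ βn + a) ⊎ (ix α (m + r) ≢ m × ix σ (a + suc b + r) ≡ ix α (m + r))
    vT r lt with ix α (m + r) ≡ᵇ m in e
    ... | true  = inj₁ (≡ᵇ-true _ _ e , trans (ixT r lt) (cong (λ c → if c then βn + a else ix α (m + r)) e))
    ... | false = inj₂ (≡ᵇ-false⁻ e , trans (ixT r lt) (cong (λ c → if c then βn + a else ix α (m + r)) e))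

    Hi Mi Lo : ℕ → Set
    Hi v = a + suc b < v × v ≤ N
    Mi v = a < v × v ≤ a + suc b
    Lo v = 1 ≤ v × v ≤ a

    hiV : ∀ x → suc a < x → x ≤ suc a + suc a → Hi (x + b)
    hiV x l u = subst (_≤ x + b) (id1 a b) (+-monoˡ-≤ b l) , subst (x + b ≤_) (id2 a b) (+-monoˡ-≤ b u)
      where
      id1 : ∀ a b → suc (suc a) + b ≡ suc (a + suc b)
      id1 = solve-∀
      id2 : ∀ a b → suc a + suc a + b ≡ a + suc b + suc a
      id2 = solve-∀

    miV : ∀ y → 1 ≤ y → y ≤ suc b → Mi (y + a)
    miV y l u = +-monoˡ-≤ a l , subst (y + a ≤_) (+-comm (suc b) a) (+-monoˡ-≤ a u)

    loV : ∀ r → r < suc a → ix α (m + r) ≢ m → Lo (ix α (m + r))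
    loV r lt ne = proj₁ (αTl r lt) , ≤-pred (≤∧≢⇒< (proj₂ (αTl r lt)) ne)

    hm : ∀ {v w} → Hi v → Mi w → v ≢ w
    hm (h , _) (_ , m′) refl = <⇒≱ h m′
    hl : ∀ {v w} → Hi v → Lo w → v ≢ w
    hl (h , _) (_ , l) refl = <⇒≱ h (≤-trans l (m≤m+n a (suc b)))
    ml : ∀ {v w} → Mi v → Lo w → v ≢ w
    ml (h , _) (_ , l) refl = <⇒≱ h l

    data Entry (i : ℕ) : Set where
      pvP  : ∀ p → p < a → i ≡ p → ix σ i ≡ ix α p + b → Entry i
      pvBS : ∀ q → q < suc b → i ≡ a + q → ix β q ≡ n → ix σ i ≡ αm + b → Entry i
      pvBM : ∀ q → q < suc b → i ≡ a + q → ix β q ≢ n → ix σ i ≡ ix β q + a → Entry i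
      pvTS : ∀ r → r < suc a → i ≡ a + suc b + r → ix α (m + r) ≡ m → ix σ i ≡ βn + a → Entry i
      pvTL : ∀ r → r < suc a → i ≡ a + suc b + r → ix α (m + r) ≢ m → ix σ i ≡ ix α (m + r) → Entry i

    entry : ∀ i → i < N → Entry i
    entry i lt with cls i lt
    ... | cP p pl refl = pvP p pl refl (ixP p pl)
    ... | cB q ql refl with vB q ql
    ...   | inj₁ (x , y) = pvBS q ql refl x y
    ...   | inj₂ (x , y) = pvBM q ql refl x y
    entry i lt | cT r rl refl with vT r rl
    ...   | inj₁ (x , y) = pvTS r rl refl x y
    ...   | inj₂ (x , y) = pvTL r rl refl x y

    αpl : ∀ p → p < a → p < suc a + suc a
    αpl p l = ≤-trans (m≤n⇒m≤1+n l) (m≤m+n (suc a) (suc a))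
    αal : a < suc a + suc a
    αal = ≤-trans (n<1+n a) (m≤m+n (suc a) (suc a))
    αtl : ∀ r → r < suc a → m + r < suc a + suc a
    αtl r l = +-monoʳ-< m l

    hP : ∀ {i} p → p < a → ix σ i ≡ ix α p + b → Hi (ix σ i)
    hP p pl e = subst Hi (sym e) (hiV _ (proj₁ (αPre p (m≤n⇒m≤1+n pl))) (proj₂ (αPre p (m≤n⇒m≤1+n pl))))
    hBS : ∀ {i} → ix σ i ≡ αm + b → Hi (ix σ i)
    hBS e = subst Hi (sym e) (hiV _ (proj₁ (αPre a ≤-refl)) (proj₂ (αPre a ≤-refl)))
    mBM : ∀ {i} q → q < suc b → ix β q ≢ n → ix σ i ≡ ix β q + a → Mi (ix σ i)
    mBM q ql ne e = subst Mi (sym e) (miV _ (proj₁ (βM q (m≤n⇒m≤1+n ql) ne)) (proj₂ (βM q (m≤n⇒m≤1+n ql) ne)))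
    mTS : ∀ {i} → ix σ i ≡ βn + a → Mi (ix σ i)
    mTS e = subst Mi (sym e) (miV _ (proj₁ βnM) (proj₂ βnM))
    lTL : ∀ {i} r → r < suc a → ix α (m + r) ≢ m → ix σ i ≡ ix α (m + r) → Lo (ix σ i)
    lTL r rl ne e = subst Lo (sym e) (loV r rl ne)

    valH : ∀ {i} → Entry i → Hi (ix σ i) ⊎ (Mi (ix σ i) ⊎ Lo (ix σ i))
    valH (pvP p pl _ e)     = inj₁ (hP p pl e)
    valH (pvBS _ _ _ _ e)   = inj₁ (hBS e)
    valH (pvBM q ql _ ne e) = inj₂ (inj₁ (mBM q ql ne e))
    valH (pvTS _ _ _ _ e)   = inj₂ (inj₁ (mTS e))
    valH (pvTL r rl _ ne e) = inj₂ (inj₂ (lTL r rl ne e))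

    σinj : ∀ i j → i < N → j < N → ix σ i ≡ ix σ j → i ≡ j
    σinj i j li lj e with entry i li | entry j lj
    ... | pvP p pl refl e1 | pvP p′ pl′ refl e2 = inj Pα p p′ (αpl p pl) (αpl p′ pl′) (+-cancelʳ-≡ _ _ _ (trans (sym e1) (trans e e2)))
    ... | pvP p pl refl e1 | pvBS q ql refl _ e2 = ⊥-elim (<⇒≢ pl (inj Pα p a (αpl p pl) αal (+-cancelʳ-≡ _ _ _ (trans (sym e1) (trans e e2)))))
    ... | pvP p pl refl e1 | pvBM q ql refl ne e2 = ⊥-elim (hm (hP p pl e1) (mBM q ql ne e2) e)
    ... | pvP p pl refl e1 | pvTS r rl refl _ e2 = ⊥-elim (hm (hP p pl e1) (mTS e2) e)
    ... | pvP p pl refl e1 | pvTL r rl refl ne e2 = ⊥-elim (hl (hP p pl e1) (lTL r rl ne e2) e)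
    ... | pvBS q ql refl _ e2 | pvP p pl refl e1 = ⊥-elim (<⇒≢ pl (inj Pα p a (αpl p pl) αal (+-cancelʳ-≡ _ _ _ (trans (sym e1) (trans (sym e) e2)))))
    ... | pvBS q ql refl b1 e1 | pvBS q′ ql′ refl b2 e2 = cong (a +_) (inj Pβ q q′ (m≤n⇒m≤1+n ql) (m≤n⇒m≤1+n ql′) (trans b1 (sym b2)))
    ... | pvBS q ql refl _ e1 | pvBM q′ ql′ refl ne e2 = ⊥-elim (hm (hBS e1) (mBM q′ ql′ ne e2) e)
    ... | pvBS q ql refl _ e1 | pvTS r rl refl _ e2 = ⊥-elim (hm (hBS e1) (mTS e2) e)
    ... | pvBS q ql refl _ e1 | pvTL r rl refl ne e2 = ⊥-elim (hl (hBS e1) (lTL r rl ne e2) e)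
    ... | pvBM q ql refl ne e1 | pvP p pl refl e2 = ⊥-elim (hm (hP p pl e2) (mBM q ql ne e1) (sym e))
    ... | pvBM q ql refl ne e1 | pvBS q′ ql′ refl _ e2 = ⊥-elim (hm (hBS e2) (mBM q ql ne e1) (sym e))
    ... | pvBM q ql refl ne e1 | pvBM q′ ql′ refl ne′ e2 = cong (a +_) (inj Pβ q q′ (m≤n⇒m≤1+n ql) (m≤n⇒m≤1+n ql′) (+-cancelʳ-≡ _ _ _ (trans (sym e1) (trans e e2))))
    ... | pvBM q ql refl ne e1 | pvTS r rl refl _ e2 = ⊥-elim (<⇒≢ ql (inj Pβ q (suc b) (m≤n⇒m≤1+n ql) ≤-refl (+-cancelʳ-≡ _ _ _ (trans (sym e1) (trans e e2)))))
    ... | pvBM q ql refl ne e1 | pvTL r rl refl ne′ e2 = ⊥-elim (ml (mBM q ql ne e1) (lTL r rl ne′ e2) e)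
    ... | pvTS r rl refl _ e1 | pvP p pl refl e2 = ⊥-elim (hm (hP p pl e2) (mTS e1) (sym e))
    ... | pvTS r rl refl _ e1 | pvBS q ql refl _ e2 = ⊥-elim (hm (hBS e2) (mTS e1) (sym e))
    ... | pvTS r rl refl _ e1 | pvBM q ql refl ne e2 = ⊥-elim (<⇒≢ ql (inj Pβ q (suc b) (m≤n⇒m≤1+n ql) ≤-refl (+-cancelʳ-≡ _ _ _ (trans (sym e2) (trans (sym e) e1)))))
    ... | pvTS r rl refl t1 e1 | pvTS r′ rl′ refl t2 e2 = cong (a + suc b +_) (+-cancelˡ-≡ m _ _ (inj Pα (m + r) (m + r′) (αtl r rl) (αtl r′ rl′) (trans t1 (sym t2))))
    ... | pvTS r rl refl _ e1 | pvTL r′ rl′ refl ne e2 = ⊥-elim (ml (mTS e1) (lTL r′ rl′ ne e2) e)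
    ... | pvTL r rl refl ne e1 | pvP p pl refl e2 = ⊥-elim (hl (hP p pl e2) (lTL r rl ne e1) (sym e))
    ... | pvTL r rl refl ne e1 | pvBS q ql refl _ e2 = ⊥-elim (hl (hBS e2) (lTL r rl ne e1) (sym e))
    ... | pvTL r rl refl ne e1 | pvBM q ql refl ne′ e2 = ⊥-elim (ml (mBM q ql ne′ e2) (lTL r rl ne e1) (sym e))
    ... | pvTL r rl refl ne e1 | pvTS r′ rl′ refl _ e2 = ⊥-elim (ml (mTS e2) (lTL r rl ne e1) (sym e))
    ... | pvTL r rl refl ne e1 | pvTL r′ rl′ refl ne′ e2 = cong (a + suc b +_) (+-cancelˡ-≡ m _ _ (inj Pα (m + r) (m + r′) (αtl r rl) (αtl r′ rl′) (trans (sym e1) (trans e e2))))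

    σrng : ∀ i → i < N → 1 ≤ ix σ i × ix σ i ≤ N
    σrng i li with valH (entry i li)
    ... | inj₁ (h , u) = ≤-trans (s≤s z≤n) h , u
    ... | inj₂ (inj₁ (h , u)) = ≤-trans (s≤s z≤n) h , ≤-trans u (m≤m+n (a + suc b) (suc a))
    ... | inj₂ (inj₂ (h , u)) = h , ≤-trans u (≤-trans (m≤m+n a (suc b)) (m≤m+n (a + suc b) (suc a)))

    σPerm : IsPerm N σ
    σPerm = injective⇒IsPerm N σ lenσ σrng σinj

-- Abstract, since unfolding these projections slows down the case analyses below considerably.
module StarSetting (a b : ℕ) (α β : List ℕ) (fα : InA′ a α) (fβ : Cycle132 (suc (suc b)) β) where
  abstract
    Pα : IsPerm (suc a + suc a) α
    Pα = InA′.P fα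
    Hα : HighThenLow (suc a) α
    Hα = InA′.H fα
    Pβ : IsPerm (suc (suc b)) β
    Pβ = Cycle132.P fβ
    βn≢ : ix β (suc b) ≢ suc (suc b)
    βn≢ = last≢length b β fβ
    Lα : length α ≡ suc a + suc a
    Lα = len Pα
    Lβ : length β ≡ suc (suc b)
    Lβ = len Pβ
  open Star a b α β Lα Lβ public
  open Entries Pα Hα Pβ βn≢ public

-- The cycle of α ⊛ β is that of α (Lo and Hi bands) with the point m replaced by the path of
-- β from β_n up to the point before n (shifted into the Mi band).
module StarCycle (a b : ℕ) (α β : List ℕ) (fα : InA′ a α) (fβ : Cycle132 (suc (suc b)) β) where
  open StarSetting a b α β fα fβ

  atP : ∀ p → p < a → at σ (suc p) ≡ ix α p + b
  atP p l = trans (at-suc σ p) (ixP p l)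
  atB : ∀ q → q < suc b → at σ (suc (a + q)) ≡ βb (ix β q)
  atB q l = trans (at-suc σ (a + q)) (ixB q l)
  atT : ∀ r → r < suc a → at σ (suc (a + suc b + r)) ≡ αb (ix α (m + r))
  atT r l = trans (at-suc σ _) (ixT r l)

  Rσ : ℕ → Set
  Rσ v = ∃ λ t → iter (at σ) t 1 ≡ v

  step : ∀ {v} → Rσ v → Rσ (at σ v)
  step (t , e) = suc t , trans (iter-suc (at σ) t 1) (cong (at σ) e)

  βb-n : βb n ≡ αm + b
  βb-n rewrite ≡ᵇ-refl n = refl
  βb-ne : ∀ y → y ≢ n → βb y ≡ y + a
  βb-ne y ne rewrite ≡ᵇ-false y n ne = refl
  αb-m : αb m ≡ βn + a
  αb-m rewrite ≡ᵇ-refl m = refl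
  αb-ne : ∀ x → x ≢ m → αb x ≡ x
  αb-ne x ne rewrite ≡ᵇ-false x m ne = refl

  blk : ∀ t y → 1 ≤ y → y ≤ suc b → iter (at β) t y ≡ n → Rσ (a + y) → Rσ (αm + b)
  blk zero    y _ yl e _ = ⊥-elim (<⇒≢ (s≤s yl) e)
  blk (suc t) (suc q) _ ql e r with ix β q ≟ n
  ... | yes bq = subst Rσ (trans (atB q ql) (trans (cong βb bq) βb-n)) (subst (λ z → Rσ (at σ z)) (+-suc a q) (step r))
  ... | no  nb = blk t (ix β q) (proj₁ (βM q (m≤n⇒m≤1+n ql) nb)) (proj₂ (βM q (m≤n⇒m≤1+n ql) nb)) (trans (cong (iter (at β) t) (sym (at-suc β q))) e)
                   (subst Rσ (trans (atB q ql) (trans (βb-ne _ nb) (+-comm _ a))) (subst (λ z → Rσ (at σ z)) (+-suc a q) (step r)))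

  module _ (a1 : 1 ≤ a) where
    CPα : OrbitInduction (suc a + suc a) (at α)
    CPα = isNCycle⇒OrbitInduction Pα (InA′.cy fα) (s≤s z≤n)
    CPβ : OrbitInduction (suc (suc b)) (at β)
    CPβ = isNCycle⇒OrbitInduction Pβ (Cycle132.cy fβ) (s≤s z≤n)
    Fβ = IsPerm⇒IsPermFun Pβ

    reachβ : ∀ y → InRange n y → ∃ λ t → iter (at β) t y ≡ n
    reachβ y ry = CPβ (λ w → ∃ λ t → iter (at β) t y ≡ w) (λ v _ (t , e) → suc t , trans (iter-suc (at β) t y) (cong (at β) e)) y ry (0 , refl) n (s≤s z≤n , ≤-refl)

    βn-at : at β n ≡ βn
    βn-at = at-suc β (suc b)

    toE : Rσ (a + βn) → Rσ (αm + b)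
    toE r = let (t , e) = reachβ βn (proj₁ (βR (suc b) ≤-refl) , proj₂ (βR (suc b) ≤-refl)) in
            blk t βn (proj₁ βnM) (proj₂ βnM) e r

    Qα : ℕ → Set
    Qα x = (x ≤ a → Rσ x) × (x ≡ m → Rσ (a + βn)) × (m < x → Rσ (x + b))

    idT : ∀ r → suc (m + r) + b ≡ suc (a + suc b + r)
    idT r = lem a b r
      where lem : ∀ a b r → suc (suc a + r) + b ≡ suc (a + suc b + r)
            lem = solve-∀

    clα : ∀ v → InRange (suc a + suc a) v → Qα v → Qα (at α v)
    clα (suc p) (_ , pl) (q1 , q2 , q3) with <-cmp p a
    ... | tri< pa _ _ = let w = αPre p (m≤n⇒m≤1+n pa) ; ev = at-suc α p in
        (λ le → ⊥-elim (<⇒≱ (proj₁ w) (≤-trans (subst (_≤ a) ev le) (n≤1+n a)))) ,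
        (λ e → ⊥-elim (<⇒≢ (proj₁ w) (sym (trans (sym ev) e)))) ,
        (λ _ → subst Rσ (trans (atP p pa) (cong (_+ b) (sym ev))) (step (q1 pa)))
    ... | tri≈ _ refl _ = let w = αPre a ≤-refl ; ev = at-suc α a in
        (λ le → ⊥-elim (<⇒≱ (proj₁ w) (≤-trans (subst (_≤ a) ev le) (n≤1+n a)))) ,
        (λ e → ⊥-elim (<⇒≢ (proj₁ w) (sym (trans (sym ev) e)))) ,
        (λ _ → subst (λ z → Rσ (z + b)) (sym ev) (toE (q2 refl)))
    ... | tri> _ _ ap = body
      where
      r = p ∸ m
      pr : m + r ≡ p
      pr = m+[n∸m]≡n ap
      rl : r < suc a
      rl = +-cancelˡ-< m r (suc a) (subst (_< m + suc a) (sym pr) pl)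
      ev : at α (suc p) ≡ ix α (m + r)
      ev = trans (at-suc α p) (cong (ix α) (sym pr))
      Rv : Rσ (suc (a + suc b + r))
      Rv = subst Rσ (trans (cong (λ z → suc z + b) (sym pr)) (idT r)) (q3 (s≤s ap))
      R2 : Rσ (αb (ix α (m + r)))
      R2 = subst Rσ (atT r rl) (step Rv)
      body : Qα (at α (suc p))
      body with ix α (m + r) ≟ m
      ... | yes em = (λ le → ⊥-elim (<⇒≱ (≤-reflexive (sym (trans ev em))) le)) ,
                     (λ _ → subst Rσ (trans (cong αb em) (trans αb-m (+-comm βn a))) R2) ,
                     (λ lt → ⊥-elim (<⇒≢ lt (sym (trans ev em))))
      ... | no ne = (λ _ → subst Rσ (trans (αb-ne _ ne) (sym ev)) R2) ,
                    (λ e → ⊥-elim (ne (trans (sym ev) e))) ,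
                    (λ lt → ⊥-elim (<⇒≱ lt (subst (_≤ m) (sym ev) (proj₂ (αTl r rl)))))

    Qα1 : Qα 1
    Qα1 = (λ _ → 0 , refl) , (λ e → ⊥-elim (<⇒≢ (s≤s a1) e)) , (λ lt → ⊥-elim (<⇒≱ lt (s≤s z≤n)))

    allα : ∀ x → InRange (suc a + suc a) x → Qα x
    allα = CPα Qα clα 1 (≤-refl , s≤s z≤n) Qα1

    Rm : Rσ (a + βn)
    Rm = proj₁ (proj₂ (allα m (s≤s z≤n , m≤m+n m m))) refl

    Qβ : ℕ → Set
    Qβ y = y ≡ n ⊎ (y ≤ suc b × Rσ (a + y))

    clβ : ∀ v → InRange n v → Qβ v → Qβ (at β v)
    clβ v _ (inj₁ refl) = inj₂ (subst (_≤ suc b) (sym βn-at) (proj₂ βnM) , subst (λ z → Rσ (a + z)) (sym βn-at) Rm)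
    clβ (suc q) _ (inj₂ (ql , r)) with ix β q ≟ n
    ... | yes e = inj₁ (trans (at-suc β q) e)
    ... | no ne = inj₂ (subst (_≤ suc b) (sym (at-suc β q)) (proj₂ (βM q (m≤n⇒m≤1+n ql) ne)) ,
                        subst Rσ (trans (atB q ql) (trans (βb-ne _ ne) (trans (+-comm _ a) (cong (a +_) (sym (at-suc β q))))))
                                  (subst (λ z → Rσ (at σ z)) (+-suc a q) (step r)))

    allβ : ∀ y → InRange n y → Qβ y
    allβ = CPβ Qβ clβ n (s≤s z≤n , ≤-refl) (inj₁ refl)

    reachAll : ∀ v → InRange N v → Rσ v
    reachAll (suc i) (_ , il) with cls i il
    ... | cP p pl refl = proj₁ (allα (suc p) (s≤s z≤n , ≤-trans (s≤s (<⇒≤ pl)) (m≤m+n (suc a) (suc a)))) pl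
    ... | cB q ql refl with allβ (suc q) (s≤s z≤n , m≤n⇒m≤1+n ql)
    ...   | inj₁ e = ⊥-elim (<⇒≢ ql (suc-injective e))
    ...   | inj₂ (_ , r) = subst Rσ (+-suc a q) r
    reachAll (suc i) (_ , il) | cT r rl refl =
      subst Rσ (idT r) (proj₂ (proj₂ (allα (suc (m + r)) (s≤s z≤n , +-monoʳ-< m rl))) (s≤s (m≤m+n m r)))

    σcyc : isNCycle N σ ≡ true
    σcyc = reachable⇒isNCycle N σ reachAll

-- A 132 pattern of α ⊛ β would come entirely from α or entirely from β: an entry of β shifted
-- into the Mi band forces the other two entries of the pattern to come from β as well.
module StarAvoids (a b : ℕ) (α β : List ℕ) (fα : InA′ a α) (fβ : Cycle132 (suc (suc b)) β) where
  open StarSetting a b α β fα fβ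

  αK : ∀ {i} → Entry i → Set
  αK (pvBM _ _ _ _ _) = ⊥
  αK _ = ⊤
  βK : ∀ {i} → Entry i → Set
  βK (pvP _ _ _ _) = ⊥
  βK (pvTL _ _ _ _ _) = ⊥
  βK _ = ⊤

  sα : ∀ {i} → Entry i → ℕ
  sα (pvP p _ _ _) = p
  sα (pvBS _ _ _ _ _) = a
  sα (pvBM _ _ _ _ _) = 0
  sα (pvTS r _ _ _ _) = m + r
  sα (pvTL r _ _ _ _) = m + r

  sβ : ∀ {i} → Entry i → ℕ
  sβ (pvP _ _ _ _) = 0
  sβ (pvBS q _ _ _ _) = q
  sβ (pvBM q _ _ _ _) = q
  sβ (pvTS _ _ _ _ _) = suc b
  sβ (pvTL _ _ _ _ _) = 0

  sα-bd : ∀ {i} (x : Entry i) → αK x → sα x < suc a + suc a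
  sα-bd (pvP p pl _ _) _ = αpl p pl
  sα-bd (pvBS _ _ _ _ _) _ = αal
  sα-bd (pvTS r rl _ _ _) _ = αtl r rl
  sα-bd (pvTL r rl _ _ _) _ = αtl r rl

  sβ-bd : ∀ {i} (x : Entry i) → βK x → sβ x < n
  sβ-bd (pvBS q ql _ _ _) _ = m≤n⇒m≤1+n ql
  sβ-bd (pvBM q ql _ _ _) _ = m≤n⇒m≤1+n ql
  sβ-bd (pvTS _ _ _ _ _) _ = ≤-refl

  sα-mono : ∀ {i j} (x : Entry i) (y : Entry j) → αK x → αK y → i < j → sα x < sα y
  sα-mono (pvP p _ refl _) (pvP p′ _ refl _) _ _ lt = lt
  sα-mono (pvP p pl refl _) (pvBS _ _ _ _ _) _ _ _ = pl
  sα-mono (pvP p pl refl _) (pvTS r _ _ _ _) _ _ _ = ≤-trans (m≤n⇒m≤1+n pl) (m≤m+n m r)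
  sα-mono (pvP p pl refl _) (pvTL r _ _ _ _) _ _ _ = ≤-trans (m≤n⇒m≤1+n pl) (m≤m+n m r)
  sα-mono (pvBS q ql refl _ _) (pvP p pl refl _) _ _ lt = ⊥-elim (<⇒≱ (<-trans lt pl) (m≤m+n a q))
  sα-mono (pvBS q ql refl b1 _) (pvBS q′ ql′ refl b2 _) _ _ lt =
    ⊥-elim (<⇒≢ lt (cong (a +_) (inj Pβ q q′ (m≤n⇒m≤1+n ql) (m≤n⇒m≤1+n ql′) (trans b1 (sym b2)))))
  sα-mono (pvBS _ _ _ _ _) (pvTS r _ _ _ _) _ _ _ = ≤-trans (n<1+n a) (m≤m+n m r)
  sα-mono (pvBS _ _ _ _ _) (pvTL r _ _ _ _) _ _ _ = ≤-trans (n<1+n a) (m≤m+n m r)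
  sα-mono (pvTS r _ refl _ _) (pvP p pl refl _) _ _ lt = ⊥-elim (<⇒≱ (<-trans lt pl) (≤-trans (m≤m+n a (suc b)) (m≤m+n (a + suc b) r)))
  sα-mono (pvTS r _ refl _ _) (pvBS q ql refl _ _) _ _ lt = ⊥-elim (<⇒≱ (<-trans lt (+-monoʳ-< a ql)) (m≤m+n (a + suc b) r))
  sα-mono (pvTS r _ refl _ _) (pvTS r′ _ refl _ _) _ _ lt = +-monoʳ-< m (+-cancelˡ-< (a + suc b) r r′ lt)
  sα-mono (pvTS r _ refl _ _) (pvTL r′ _ refl _ _) _ _ lt = +-monoʳ-< m (+-cancelˡ-< (a + suc b) r r′ lt)
  sα-mono (pvTL r _ refl _ _) (pvP p pl refl _) _ _ lt = ⊥-elim (<⇒≱ (<-trans lt pl) (≤-trans (m≤m+n a (suc b)) (m≤m+n (a + suc b) r)))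
  sα-mono (pvTL r _ refl _ _) (pvBS q ql refl _ _) _ _ lt = ⊥-elim (<⇒≱ (<-trans lt (+-monoʳ-< a ql)) (m≤m+n (a + suc b) r))
  sα-mono (pvTL r _ refl _ _) (pvTS r′ _ refl _ _) _ _ lt = +-monoʳ-< m (+-cancelˡ-< (a + suc b) r r′ lt)
  sα-mono (pvTL r _ refl _ _) (pvTL r′ _ refl _ _) _ _ lt = +-monoʳ-< m (+-cancelˡ-< (a + suc b) r r′ lt)

  sβ-mono : ∀ {i j} (x : Entry i) (y : Entry j) → βK x → βK y → i < j → sβ x < sβ y
  sβ-mono (pvBS q _ refl _ _) (pvBS q′ _ refl _ _) _ _ lt = +-cancelˡ-< a q q′ lt
  sβ-mono (pvBS q _ refl _ _) (pvBM q′ _ refl _ _) _ _ lt = +-cancelˡ-< a q q′ lt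
  sβ-mono (pvBM q _ refl _ _) (pvBS q′ _ refl _ _) _ _ lt = +-cancelˡ-< a q q′ lt
  sβ-mono (pvBM q _ refl _ _) (pvBM q′ _ refl _ _) _ _ lt = +-cancelˡ-< a q q′ lt
  sβ-mono (pvBS q ql refl _ _) (pvTS _ _ _ _ _) _ _ _ = ql
  sβ-mono (pvBM q ql refl _ _) (pvTS _ _ _ _ _) _ _ _ = ql
  sβ-mono (pvTS r _ refl _ _) (pvBS q ql refl _ _) _ _ lt = ⊥-elim (<⇒≱ (<-trans lt (+-monoʳ-< a ql)) (m≤m+n (a + suc b) r))
  sβ-mono (pvTS r _ refl _ _) (pvBM q ql refl _ _) _ _ lt = ⊥-elim (<⇒≱ (<-trans lt (+-monoʳ-< a ql)) (m≤m+n (a + suc b) r))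
  sβ-mono (pvTS r rl refl t1 _) (pvTS r′ rl′ refl t2 _) _ _ lt =
    ⊥-elim (<⇒≢ lt (cong (a + suc b +_) (+-cancelˡ-≡ m _ _ (inj Pα (m + r) (m + r′) (αtl r rl) (αtl r′ rl′) (trans t1 (sym t2))))))

  HM< : ∀ {v w} → Hi v → Mi w → v < w → ⊥
  HM< (h , _) (_ , u) lt = <⇒≱ (<-trans h lt) u
  HL< : ∀ {v w} → Hi v → Lo w → v < w → ⊥
  HL< (h , _) (_ , u) lt = <⇒≱ (<-trans h lt) (≤-trans u (m≤m+n a (suc b)))
  ML< : ∀ {v w} → Mi v → Lo w → v < w → ⊥
  ML< (h , _) (_ , u) lt = <⇒≱ (<-trans h lt) u

  ordα : ∀ {i j} (x : Entry i) (y : Entry j) → αK x → αK y → ix σ i < ix σ j → ix α (sα x) < ix α (sα y)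
  ordα (pvP p _ _ e1) (pvP p′ _ _ e2) _ _ lt = +-cancelʳ-< _ _ _ (subst₂ _<_ e1 e2 lt)
  ordα (pvP p _ _ e1) (pvBS _ _ _ _ e2) _ _ lt = +-cancelʳ-< _ _ _ (subst₂ _<_ e1 e2 lt)
  ordα (pvBS _ _ _ _ e1) (pvP p′ _ _ e2) _ _ lt = +-cancelʳ-< _ _ _ (subst₂ _<_ e1 e2 lt)
  ordα (pvBS _ _ _ _ e1) (pvBS _ _ _ _ e2) _ _ lt = +-cancelʳ-< _ _ _ (subst₂ _<_ e1 e2 lt)
  ordα (pvP p pl _ e1) (pvTS _ _ _ _ e2) _ _ lt = ⊥-elim (HM< (hP p pl e1) (mTS e2) lt)
  ordα (pvP p pl _ e1) (pvTL r rl _ ne e2) _ _ lt = ⊥-elim (HL< (hP p pl e1) (lTL r rl ne e2) lt)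
  ordα (pvBS _ _ _ _ e1) (pvTS _ _ _ _ e2) _ _ lt = ⊥-elim (HM< (hBS e1) (mTS e2) lt)
  ordα (pvBS _ _ _ _ e1) (pvTL r rl _ ne e2) _ _ lt = ⊥-elim (HL< (hBS e1) (lTL r rl ne e2) lt)
  ordα (pvTS r _ _ t _) (pvP p pl _ _) _ _ _ = subst (_< ix α p) (sym t) (proj₁ (αPre p (m≤n⇒m≤1+n pl)))
  ordα (pvTS r _ _ t _) (pvBS _ _ _ _ _) _ _ _ = subst (_< ix α a) (sym t) (proj₁ (αPre a ≤-refl))
  ordα (pvTS _ _ _ _ e1) (pvTS _ _ _ _ e2) _ _ lt = ⊥-elim (<-irrefl refl (subst₂ _<_ e1 e2 lt))
  ordα (pvTS _ _ _ _ e1) (pvTL r rl _ ne e2) _ _ lt = ⊥-elim (ML< (mTS e1) (lTL r rl ne e2) lt)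
  ordα (pvTL r rl _ ne _) (pvP p pl _ _) _ _ _ = <-trans (s≤s (proj₂ (loV r rl ne))) (proj₁ (αPre p (m≤n⇒m≤1+n pl)))
  ordα (pvTL r rl _ ne _) (pvBS _ _ _ _ _) _ _ _ = <-trans (s≤s (proj₂ (loV r rl ne))) (proj₁ (αPre a ≤-refl))
  ordα (pvTL r rl _ ne _) (pvTS _ _ _ t _) _ _ _ = subst (ix α (m + r) <_) (sym t) (s≤s (proj₂ (loV r rl ne)))
  ordα (pvTL _ _ _ _ e1) (pvTL _ _ _ _ e2) _ _ lt = subst₂ _<_ e1 e2 lt

  ordβ : ∀ {i j} (x : Entry i) (y : Entry j) → βK x → βK y → ix σ i < ix σ j → ix β (sβ x) < ix β (sβ y)
  ordβ (pvBS _ _ _ _ e1) (pvBS _ _ _ _ e2) _ _ lt = ⊥-elim (<-irrefl refl (subst₂ _<_ e1 e2 lt))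
  ordβ (pvBS _ _ _ _ e1) (pvBM q ql _ ne e2) _ _ lt = ⊥-elim (HM< (hBS e1) (mBM q ql ne e2) lt)
  ordβ (pvBS _ _ _ _ e1) (pvTS _ _ _ _ e2) _ _ lt = ⊥-elim (HM< (hBS e1) (mTS e2) lt)
  ordβ (pvBM q ql _ ne _) (pvBS q′ _ _ bq _) _ _ _ = subst (ix β q <_) (sym bq) (s≤s (proj₂ (βM q (m≤n⇒m≤1+n ql) ne)))
  ordβ (pvTS _ _ _ _ _) (pvBS q′ _ _ bq _) _ _ _ = subst (βn <_) (sym bq) (s≤s (proj₂ βnM))
  ordβ (pvBM _ _ _ _ e1) (pvBM _ _ _ _ e2) _ _ lt = +-cancelʳ-< _ _ _ (subst₂ _<_ e1 e2 lt)
  ordβ (pvBM _ _ _ _ e1) (pvTS _ _ _ _ e2) _ _ lt = +-cancelʳ-< _ _ _ (subst₂ _<_ e1 e2 lt)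
  ordβ (pvTS _ _ _ _ e1) (pvBM _ _ _ _ e2) _ _ lt = +-cancelʳ-< _ _ _ (subst₂ _<_ e1 e2 lt)
  ordβ (pvTS _ _ _ _ e1) (pvTS _ _ _ _ e2) _ _ lt = +-cancelʳ-< _ _ _ (subst₂ _<_ e1 e2 lt)

  >a-before-tail : ∀ {i} (x : Entry i) → i < a + suc b → a < ix σ i
  >a-before-tail (pvP p pl _ e) _ = <-trans (m<m+n a (s≤s z≤n)) (proj₁ (hP p pl e))
  >a-before-tail (pvBS _ _ _ _ e) _ = <-trans (m<m+n a (s≤s z≤n)) (proj₁ (hBS e))
  >a-before-tail (pvBM q ql _ ne e) _ = proj₁ (mBM q ql ne e)
  >a-before-tail (pvTS r _ refl _ _) lt = ⊥-elim (<⇒≱ lt (m≤m+n (a + suc b) r))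
  >a-before-tail (pvTL r _ refl _ _) lt = ⊥-elim (<⇒≱ lt (m≤m+n (a + suc b) r))

  Hi-in-prefix : ∀ {i} (x : Entry i) → i < a → Hi (ix σ i)
  Hi-in-prefix (pvP p pl _ e) _ = hP p pl e
  Hi-in-prefix (pvBS q _ refl _ _) lt = ⊥-elim (<⇒≱ lt (m≤m+n a q))
  Hi-in-prefix (pvBM q _ refl _ _) lt = ⊥-elim (<⇒≱ lt (m≤m+n a q))
  Hi-in-prefix (pvTS r _ refl _ _) lt = ⊥-elim (<⇒≱ lt (≤-trans (m≤m+n a (suc b)) (m≤m+n (a + suc b) r)))
  Hi-in-prefix (pvTL r _ refl _ _) lt = ⊥-elim (<⇒≱ lt (≤-trans (m≤m+n a (suc b)) (m≤m+n (a + suc b) r)))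

  BMi : ∀ {i} → Entry i → Set
  BMi (pvBM _ _ _ _ _) = ⊤
  BMi _ = ⊥

  BMlev : ∀ {i} (x : Entry i) → BMi x → Mi (ix σ i) × (a ≤ i × i < a + suc b)
  BMlev (pvBM q ql refl ne e) _ = mBM q ql ne e , m≤m+n a q , +-monoʳ-< a ql

  bmβ : ∀ {i} (x : Entry i) → BMi x → βK x
  bmβ (pvBM _ _ _ _ _) _ = tt

  αK? : ∀ {i} (x : Entry i) → αK x ⊎ BMi x
  αK? (pvP _ _ _ _) = inj₁ tt
  αK? (pvBS _ _ _ _ _) = inj₁ tt
  αK? (pvBM _ _ _ _ _) = inj₂ tt
  αK? (pvTS _ _ _ _ _) = inj₁ tt
  αK? (pvTL _ _ _ _ _) = inj₁ tt

  afterBM : ∀ {i j} (x : Entry i) → BMi x → (w : Entry j) → i < j → a < ix σ j → βK w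
  afterBM x bx (pvP p pl refl _) lt _ = ⊥-elim (<⇒≱ (<-trans lt pl) (proj₁ (proj₂ (BMlev x bx))))
  afterBM x bx (pvTL r rl _ ne e) _ h = ⊥-elim (<⇒≱ h (proj₂ (lTL r rl ne e)))
  afterBM x bx (pvBS _ _ _ _ _) _ _ = tt
  afterBM x bx (pvBM _ _ _ _ _) _ _ = tt
  afterBM x bx (pvTS _ _ _ _ _) _ _ = tt

  beforeBM : ∀ {i j} (y : Entry j) → BMi y → (w : Entry i) → i < j → ix σ i < ix σ j → βK w
  beforeBM y by (pvP p pl _ e) _ lt = ⊥-elim (HM< (hP p pl e) (proj₁ (BMlev y by)) lt)
  beforeBM y by (pvTL r _ refl _ _) lt _ = ⊥-elim (<⇒≱ lt (≤-trans (<⇒≤ (proj₂ (proj₂ (BMlev y by)))) (m≤m+n (a + suc b) r)))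
  beforeBM y by (pvBS _ _ _ _ _) _ _ = tt
  beforeBM y by (pvBM _ _ _ _ _) _ _ = tt
  beforeBM y by (pvTS _ _ _ _ _) _ _ = tt

  routeα : ∀ {i j k} (x : Entry i) (y : Entry j) (z : Entry k) → αK x → αK y → αK z → i < j → j < k →
           ix σ i < ix σ k → ix σ k < ix σ j → ⊥
  routeα x y z ax ay az ij jk p q =
    InA′.av fα (sα x) (sα y) (sα z) (sα-mono x y ax ay ij) (sα-mono y z ay az jk) (subst (sα z <_) (sym Lα) (sα-bd z az))
       (ordα x z ax az p) (ordα z y az ay q)

  routeβ : ∀ {i j k} (x : Entry i) (y : Entry j) (z : Entry k) → βK x → βK y → βK z → i < j → j < k →
           ix σ i < ix σ k → ix σ k < ix σ j → ⊥
  routeβ x y z ax ay az ij jk p q =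
    Cycle132.av fβ (sβ x) (sβ y) (sβ z) (sβ-mono x y ax ay ij) (sβ-mono y z ay az jk) (subst (sβ z <_) (sym Lβ) (sβ-bd z az))
       (ordβ x z ax az p) (ordβ z y az ay q)

  σavoid : Avoids132 σ
  σavoid i j k ij jk kl p q = go (entry i (<-trans ij jN)) (entry j jN) (entry k kN)
    where
    kN = subst (k <_) lenσ kl
    jN = <-trans jk kN
    go : Entry i → Entry j → Entry k → ⊥
    go x y z with αK? x | αK? y | αK? z
    ... | inj₁ ax | inj₁ ay | inj₁ az = routeα x y z ax ay az ij jk p q
    ... | inj₂ bx | _ | _ = routeβ x y z (bmβ x bx) (afterBM x bx y ij (<-trans (proj₁ (proj₁ (BMlev x bx))) (<-trans p q)))
                               (afterBM x bx z (<-trans ij jk) (<-trans (proj₁ (proj₁ (BMlev x bx))) p)) ij jk p q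
    ... | inj₁ _ | inj₂ by | _ = routeβ x y z (beforeBM y by x ij (<-trans p q)) (bmβ y by)
                               (afterBM y by z jk (<-trans (>a-before-tail x (<-trans ij (proj₂ (proj₂ (BMlev y by))))) p)) ij jk p q
    ... | inj₁ _ | inj₁ _ | inj₂ bz = routeβ x y z (beforeBM z bz x (<-trans ij jk) p) (yβ y) (bmβ z bz) ij jk p q
      where
      yβ : (w : Entry j) → βK w
      yβ (pvP p′ pl′ refl _) = ⊥-elim (HM< (Hi-in-prefix x (<-trans ij pl′)) (proj₁ (BMlev z bz)) p)
      yβ (pvTL r _ refl _ _) = ⊥-elim (<⇒≱ jk (≤-trans (<⇒≤ (proj₂ (proj₂ (BMlev z bz)))) (m≤m+n (a + suc b) r)))
      yβ (pvBS _ _ _ _ _) = tt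
      yβ (pvBM _ _ _ _ _) = tt
      yβ (pvTS _ _ _ _ _) = tt

perm-ext-missing : ∀ {N x y} → IsPerm N x → IsPerm N y → ∀ t → t < N → (∀ i → i < N → i ≢ t → ix x i ≡ ix y i) → ix x t ≡ ix y t
perm-ext-missing {N} {x} {y} Px Py t tN h with sur Py (ix x t) (proj₁ (rng Px t tN)) (proj₂ (rng Px t tN))
... | s , sN , e with s ≟ t
...   | yes refl = sym e
...   | no ne = ⊥-elim (ne (inj Px s t sN tN (trans (h s sN ne) e)))

perm-ext : ∀ {N x y} → IsPerm N x → IsPerm N y → ∀ t → t < N → (∀ i → i < N → i ≢ t → ix x i ≡ ix y i) → x ≡ y
perm-ext {N} {x} {y} Px Py t tN h = ix-ext x y (trans (len Px) (sym (len Py))) λ i il →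
  let iN = subst (i <_) (len Px) il in
  case i ≟ t of λ { (yes refl) → perm-ext-missing Px Py t tN h ; (no ne) → h i iN ne }

module StarInjective (a b : ℕ) (α β α′ β′ : List ℕ) (fα : InA′ a α) (fβ : Cycle132 (suc (suc b)) β)
                     (fα′ : InA′ a α′) (fβ′ : Cycle132 (suc (suc b)) β′)
                     (eqσ : star (suc a) (suc (suc b)) α β ≡ star (suc a) (suc (suc b)) α′ β′) where
  module S1 = StarSetting a b α β fα fβ
  module S2 = StarSetting a b α′ β′ fα′ fβ′
  open S1 using (m; n; N)

  eqix : ∀ i → ix S1.σ i ≡ ix S2.σ i
  eqix i = cong (λ l → ix l i) eqσ

  αeq-pre : ∀ p → p < a → ix α p ≡ ix α′ p
  αeq-pre p pl = +-cancelʳ-≡ b _ _ (trans (sym (S1.ixP p pl)) (trans (eqix p) (S2.ixP p pl)))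

  αeq-tl : ∀ r → r < suc a → ix α (m + r) ≡ ix α′ (m + r)
  αeq-tl r rl with S1.vT r rl | S2.vT r rl
  ... | inj₁ (t1 , _) | inj₁ (t2 , _) = trans t1 (sym t2)
  ... | inj₂ (_ , e1) | inj₂ (_ , e2) = trans (sym e1) (trans (eqix _) e2)
  ... | inj₁ (_ , e1) | inj₂ (ne , e2) = ⊥-elim (S1.ml (S1.mTS e1) (subst S1.Lo (sym (eqix _)) (S2.lTL r rl ne e2)) refl)
  ... | inj₂ (ne , e1) | inj₁ (_ , e2) = ⊥-elim (S1.ml (subst S1.Mi (sym (eqix _)) (S2.mTS e2)) (S1.lTL r rl ne e1) refl)

  αeq : α ≡ α′
  αeq = perm-ext S1.Pα S2.Pα a S1.αal h
    where
    h : ∀ i → i < suc a + suc a → i ≢ a → ix α i ≡ ix α′ i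
    h i il ne with i <? a
    ... | yes pl = αeq-pre i pl
    ... | no ¬pl = let ai = ≤∧≢⇒< (≮⇒≥ ¬pl) (λ e → ne (sym e)) ; r = i ∸ m ; pr = m+[n∸m]≡n ai in
       subst (λ z → ix α z ≡ ix α′ z) pr (αeq-tl r (+-cancelˡ-< m r (suc a) (subst (_< m + suc a) (sym pr) il)))

  βeq-bl : ∀ q → q < suc b → ix β q ≡ ix β′ q
  βeq-bl q ql with S1.vB q ql | S2.vB q ql
  ... | inj₁ (b1 , _) | inj₁ (b2 , _) = trans b1 (sym b2)
  ... | inj₂ (_ , e1) | inj₂ (_ , e2) = +-cancelʳ-≡ a _ _ (trans (sym e1) (trans (eqix _) e2))
  ... | inj₁ (_ , e1) | inj₂ (ne , e2) = ⊥-elim (S1.hm (S1.hBS e1) (subst S1.Mi (sym (eqix _)) (S2.mBM q ql ne e2)) refl)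
  ... | inj₂ (ne , e1) | inj₁ (_ , e2) = ⊥-elim (S1.hm (subst S1.Hi (sym (eqix _)) (S2.hBS e2)) (S1.mBM q ql ne e1) refl)

  βeq : β ≡ β′
  βeq = perm-ext S1.Pβ S2.Pβ (suc b) ≤-refl h
    where
    h : ∀ i → i < n → i ≢ suc b → ix β i ≡ ix β′ i
    h i il ne = βeq-bl i (≤-pred (≤∧≢⇒< il (λ e → ne (suc-injective e))))

module StarHighThenLow (a c : ℕ) (α β : List ℕ) (fα : InA′ a α) (fβ : Cycle132 (suc (suc (c + c))) β) where
  b = c + c
  open StarSetting a b α β fα fβ
  h = a + suc c

  nn : n ≡ suc c + suc c
  nn = cong suc (sym (+-suc c c))
  hh : h + h ≡ N
  hh = lem a c
    where lem : ∀ a c → a + suc c + (a + suc c) ≡ a + suc (c + c) + suc a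
          lem = solve-∀
  cb : suc c ≤ suc b
  cb = s≤s (m≤m+n c c)
  hb : h ≤ a + suc b
  hb = +-monoʳ-≤ a cb

  star-preserves-HighThenLow : HighThenLow (suc c) β → HighThenLow h σ
  star-preserves-HighThenLow (βpre , βtl) = pre , tl
    where
    pre : ∀ i → i < h → h < ix σ i
    pre i il with entry i (<-≤-trans il (≤-trans hb (m≤m+n (a + suc b) (suc a))))
    ... | pvP p pl _ e = <-≤-trans (s≤s hb) (proj₁ (hP p pl e))
    ... | pvBS _ _ _ _ e = <-≤-trans (s≤s hb) (proj₁ (hBS e))
    ... | pvBM q ql refl ne e = subst (h <_) (trans (+-comm a (ix β q)) (sym e)) (+-monoʳ-< a (βpre q (+-cancelˡ-< a q (suc c) il)))
    ... | pvTS r _ refl _ _ = ⊥-elim (<⇒≱ il (≤-trans hb (m≤m+n (a + suc b) r)))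
    ... | pvTL r _ refl _ _ = ⊥-elim (<⇒≱ il (≤-trans hb (m≤m+n (a + suc b) r)))
    tl : ∀ i → h ≤ i → i < h + h → ix σ i ≤ h
    tl i hi ih with entry i (subst (i <_) hh ih)
    ... | pvP p pl refl _ = ⊥-elim (<⇒≱ pl (≤-trans (m≤m+n a (suc c)) hi))
    ... | pvBS q ql refl bq _ = ⊥-elim (<⇒≱ (s≤s (s≤s (m≤m+n c c))) (subst (_≤ suc c) bq (βtl q (+-cancelˡ-≤ a (suc c) q hi) (subst (q <_) nn (m≤n⇒m≤1+n ql)))))
    ... | pvBM q ql refl ne e = subst (_≤ h) (sym (trans e (+-comm (ix β q) a))) (+-monoʳ-≤ a (βtl q (+-cancelˡ-≤ a (suc c) q hi) (subst (q <_) nn (m≤n⇒m≤1+n ql))))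
    ... | pvTS r _ refl _ e = subst (_≤ h) (sym (trans e (+-comm βn a))) (+-monoʳ-≤ a (βtl (suc b) cb (subst (suc b <_) nn ≤-refl)))
    ... | pvTL r rl refl ne e = subst (_≤ h) (sym e) (≤-trans (proj₂ (loV r rl ne)) (m≤m+n a (suc c)))

  star-reflects-HighThenLow : HighThenLow h σ → HighThenLow (suc c) β
  star-reflects-HighThenLow (σpre , σtl) = pre , tl
    where
    pre : ∀ q → q < suc c → suc c < ix β q
    pre q ql with vB q (<-≤-trans ql cb)
    ... | inj₁ (bq , _) = subst (suc c <_) (sym bq) (s≤s (s≤s (m≤m+n c c)))
    ... | inj₂ (ne , e) = +-cancelˡ-< a (suc c) (ix β q) (subst (h <_) (trans e (+-comm (ix β q) a)) (σpre (a + q) (+-monoʳ-< a ql)))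
    tl : ∀ q → suc c ≤ q → q < suc c + suc c → ix β q ≤ suc c
    tl q cq qn with q <? suc b
    ... | yes qb = blk
      where
      pos-tl : ix σ (a + q) ≤ h
      pos-tl = σtl (a + q) (+-monoʳ-≤ a cq) (subst (a + q <_) (sym hh) (≤-trans (+-monoʳ-< a qb) (m≤m+n (a + suc b) (suc a))))
      blk : ix β q ≤ suc c
      blk with vB q qb
      ... | inj₁ (_ , e) = ⊥-elim (<⇒≱ (<-≤-trans (s≤s hb) (proj₁ (hBS e))) pos-tl)
      ... | inj₂ (ne , e) = +-cancelˡ-≤ a (ix β q) (suc c) (subst (_≤ h) (trans e (+-comm (ix β q) a)) pos-tl)
    ... | no ¬qb = subst (_≤ suc c) (cong (ix β) (sym qeq)) βnle
      where
      qeq : q ≡ suc b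
      qeq = ≤-antisym (≤-pred (subst (q <_) (sym nn) qn)) (≮⇒≥ ¬qb)
      sm = sur Pα m (s≤s z≤n) (m≤m+n m m)
      s = proj₁ sm
      sN = proj₁ (proj₂ sm)
      es = proj₂ (proj₂ sm)
      ms : m ≤ s
      ms with s <? m
      ... | yes sl = ⊥-elim (<⇒≢ (proj₁ (αPre s sl)) (sym es))
      ... | no ¬sl = ≮⇒≥ ¬sl
      r = s ∸ m
      sr : m + r ≡ s
      sr = m+[n∸m]≡n ms
      rl : r < suc a
      rl = +-cancelˡ-< m r (suc a) (subst (_< m + suc a) (sym sr) sN)
      βnle : βn ≤ suc c
      βnle with vT r rl
      ... | inj₂ (ne , _) = ⊥-elim (ne (trans (cong (ix α) sr) es))
      ... | inj₁ (_ , e) = +-cancelˡ-≤ a βn (suc c) (subst (_≤ h) (trans e (+-comm βn a))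
                   (σtl (a + suc b + r) (≤-trans hb (m≤m+n (a + suc b) r)) (subst (a + suc b + r <_) (sym hh) (+-monoʳ-< (a + suc b) rl))))

-- If α ⊛ β = α′ ⊛ β′ with α′ longer than α, then α′ = α ⊛ γ: the first 2d + 1 entries of γ are
-- α′_{a+1} … α′_{a+2d+1} lowered by a (the one entry exceeding a + 2d + 1 becoming 2d + 2), and
-- the last is α′_{j+2d} lowered by a, where α_j = m.
module StarFactor (a d b′ : ℕ) (α β α′ β′ : List ℕ)
    (fα : InA′ a α) (fβ : Cycle132 (suc (suc (b′ + (d + d)))) β) (fα′ : InA′ (a + d) α′) (fβ′ : Cycle132 (suc (suc b′)) β′)
    (eqσ : star (suc a) (suc (suc (b′ + (d + d)))) α β ≡ star (suc (a + d)) (suc (suc b′)) α′ β′) where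
  a′ = a + d
  b = b′ + (d + d)
  module S1 = StarSetting a b α β fα fβ
  module S2 = StarSetting a′ b′ α′ β′ fα′ fβ′
  m = suc a
  m′ = suc a′
  bγ = d + d
  nγ = suc (suc bγ)

  eqix : ∀ i → ix S1.σ i ≡ ix S2.σ i
  eqix i = cong (λ l → ix l i) eqσ

  pre′ : ∀ p → p < a → ix α′ p ≡ ix α p + bγ
  pre′ p pl = +-cancelʳ-≡ b′ _ _ (trans (sym (S2.ixP p (≤-trans pl (m≤m+n a d)))) (trans (sym (eqix p)) (trans (S1.ixP p pl) (lem (ix α p) b′ d))))
    where lem : ∀ x b′ d → x + (b′ + (d + d)) ≡ x + (d + d) + b′
          lem = solve-∀

  a<m′ : a < m′
  a<m′ = s≤s (m≤m+n a d)

  BlockEntry : ℕ → Set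
  BlockEntry y = (a < y) × (a + suc bγ < y → y ≡ ix α a + bγ)

  blockEntry : ∀ q → q < suc bγ → BlockEntry (ix α′ (a + q))
  blockEntry q ql with <-cmp q d
  ... | tri< qd _ _ = body
    where
    p′ = a + q
    p′l : p′ < a′
    p′l = +-monoʳ-< a qd
    qb : q < suc b
    qb = ≤-trans qd (≤-trans (m≤m+n d d) (≤-trans (m≤n+m (d + d) b′) (n≤1+n b)))
    e2 : ix S1.σ p′ ≡ ix α′ p′ + b′
    e2 = trans (eqix p′) (S2.ixP p′ p′l)
    gt : a < ix α′ p′
    gt = <-trans a<m′ (proj₁ (S2.αPre p′ (m≤n⇒m≤1+n p′l)))
    body : BlockEntry (ix α′ p′)
    body with S1.vB q qb
    ... | inj₁ (_ , e1) = gt , λ _ → +-cancelʳ-≡ b′ _ _ (trans (sym e2) (trans e1 (lem (ix α a) b′ d)))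
      where lem : ∀ x b′ d → x + (b′ + (d + d)) ≡ x + (d + d) + b′
            lem = solve-∀
    ... | inj₂ (ne , e1) = gt , λ hi → ⊥-elim (<⇒≱ (+-monoˡ-< b′ hi) Yle)
      where
      lem : ∀ a b′ d → suc (b′ + (d + d)) + a ≡ a + suc (d + d) + b′
      lem = solve-∀
      Yle : ix α′ p′ + b′ ≤ a + suc bγ + b′
      Yle = subst₂ _≤_ (trans (sym e1) e2) (lem a b′ d) (+-monoˡ-≤ a (proj₂ (S1.βM q (m≤n⇒m≤1+n qb) ne)))
  ... | tri≈ _ refl _ = <-trans a<m′ (proj₁ (S2.αPre a′ ≤-refl)) , B2
    where
    y = ix α′ a′
    a′N : a′ < suc a′ + suc a′
    a′N = m≤m+n (suc a′) (suc a′)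
    B2 : a + suc bγ < y → y ≡ ix α a + bγ
    B2 hi = trans (sym yv) (cong (_+ bγ) (sym αt=v′))
      where
      v = y ∸ bγ
      bγy : bγ ≤ y
      bγy = ≤-trans (m≤n+m bγ a) (≤-trans (n≤1+n (a + bγ)) (≤-trans (≤-reflexive (sym (+-suc a bγ))) (<⇒≤ hi)))
      yv : v + bγ ≡ y
      yv = m∸n+n≡m bγy
      vlo : suc (suc a) ≤ v
      vlo = +-cancelʳ-≤ bγ (suc (suc a)) v (subst₂ _≤_ (cong suc (+-suc a bγ)) (sym yv) hi)
      vhi : v ≤ suc a + suc a
      vhi = +-cancelʳ-≤ bγ v (suc a + suc a) (subst₂ _≤_ (sym yv) (lem a d) (proj₂ (rng S2.Pα a′ a′N)))
        where lem : ∀ a d → suc (a + d) + suc (a + d) ≡ suc a + suc a + (d + d)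
              lem = solve-∀
      stt = sur S1.Pα v (≤-trans (s≤s z≤n) vlo) vhi
      t = proj₁ stt
      tN = proj₁ (proj₂ stt)
      αt=v = proj₂ (proj₂ stt)
      tsa : t < suc a
      tsa with t <? suc a
      ... | yes x = x
      ... | no x = ⊥-elim (<⇒≱ vlo (subst (_≤ suc a) αt=v (proj₂ S1.Hα t (≮⇒≥ x) tN)))
      αt=v′ : ix α a ≡ v
      αt=v′ with <-cmp t a
      ... | tri≈ _ e _ = subst (λ z → ix α z ≡ v) e αt=v
      ... | tri> _ _ at = ⊥-elim (<⇒≱ at (≤-pred tsa))
      ... | tri< ta _ _ = ⊥-elim (<⇒≢ (≤-trans ta (m≤m+n a d)) (inj S2.Pα t a′ (<-trans (≤-trans ta (m≤m+n a d)) a′N) a′N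
                             (trans (pre′ t ta) (trans (cong (_+ bγ) αt=v) yv))))
  ... | tri> _ _ dq = body
    where
    r′ = q ∸ suc d
    qr : suc d + r′ ≡ q
    qr = m+[n∸m]≡n dq
    r′d : r′ < d
    r′d = +-cancelˡ-< (suc d) r′ d (subst (_< suc d + d) (sym qr) ql)
    r′l : r′ < suc a′
    r′l = ≤-trans r′d (≤-trans (m≤n+m d a) (n≤1+n (a + d)))
    pos : a + q ≡ m′ + r′
    pos = trans (cong (a +_) (sym qr)) (lem a d r′)
      where lem : ∀ a d r → a + (suc d + r) ≡ suc (a + d) + r
            lem = solve-∀
    m′le : m′ ≤ a + suc bγ
    m′le = subst (_≤ a + suc bγ) (+-suc a d) (+-monoʳ-≤ a (s≤s (m≤m+n d d)))
    y≤ : ix α′ (a + q) ≤ m′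
    y≤ = subst (_≤ m′) (cong (ix α′) (sym pos)) (proj₂ (S2.αTl r′ r′l))
    B2 : a + suc bγ < ix α′ (a + q) → ix α′ (a + q) ≡ ix α a + bγ
    B2 hi = ⊥-elim (<⇒≱ hi (≤-trans y≤ m′le))
    q′′ = d + suc b′ + r′
    q′′l : q′′ < suc b
    q′′l = s≤s (subst₂ _≤_ (lem1 b′ d r′) (lem2 b′ d) (+-monoʳ-≤ (d + b′) r′d))
      where lem2 : ∀ b′ d → d + b′ + d ≡ b′ + (d + d)
            lem2 = solve-∀
            lem1 : ∀ b′ d r → d + b′ + suc r ≡ d + suc b′ + r
            lem1 = solve-∀
    posσ : a + q′′ ≡ a′ + suc b′ + r′
    posσ = lem a d b′ r′
      where lem : ∀ a d b′ r → a + (d + suc b′ + r) ≡ a + d + suc b′ + r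
            lem = solve-∀
    σgt : a < ix S1.σ (a + q′′)
    σgt with S1.vB q′′ q′′l
    ... | inj₁ (_ , e1) = <-trans (m<m+n a (s≤s z≤n)) (proj₁ (S1.hBS e1))
    ... | inj₂ (ne , e1) = proj₁ (S1.mBM q′′ q′′l ne e1)
    body : BlockEntry (ix α′ (a + q))
    body with S2.vT r′ r′l
    ... | inj₁ (t , _) = subst (a <_) (sym (trans (cong (ix α′) pos) t)) a<m′ , B2
    ... | inj₂ (ne , e2) = subst (a <_) (trans (trans (eqix (a + q′′)) (trans (cong (ix S2.σ) posσ) e2)) (cong (ix α′) (sym pos))) σgt , B2

  sm = sur S1.Pα m (s≤s z≤n) (m≤m+n m m)
  s0 = proj₁ sm
  s0N = proj₁ (proj₂ sm)
  s0e = proj₂ (proj₂ sm)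
  ms0 : m ≤ s0
  ms0 with s0 <? m
  ... | yes sl = ⊥-elim (<⇒≢ (proj₁ (S1.αPre s0 sl)) (sym s0e))
  ... | no ¬sl = ≮⇒≥ ¬sl
  r0 = s0 ∸ m
  sr0 : m + r0 ≡ s0
  sr0 = m+[n∸m]≡n ms0
  r0l : r0 < suc a
  r0l = +-cancelˡ-< m r0 (suc a) (subst (_< m + suc a) (sym sr0) s0N)
  αr0 : ix α (m + r0) ≡ m
  αr0 = trans (cong (ix α) sr0) s0e
  r0-uniq : ∀ r → r < suc a → ix α (m + r) ≡ m → r ≡ r0
  r0-uniq r rl e = +-cancelˡ-≡ m _ _ (inj S1.Pα (m + r) (m + r0) (S1.αtl r rl) (S1.αtl r0 r0l) (trans e (sym αr0)))

  Tpos : ∀ r → a + suc bγ + r ≡ m′ + (d + r)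
  Tpos r = lem a d r
    where lem : ∀ a d r → a + suc (d + d) + r ≡ suc (a + d) + (d + r)
          lem = solve-∀

  Tfact : ∀ r → r < suc a → (ix α (m + r) ≢ m → ix α′ (a + suc bγ + r) ≡ ix α (m + r)) × (ix α (m + r) ≡ m → a < ix α′ (a + suc bγ + r))
  Tfact r rl = body
    where
    dr : d + r < suc a′
    dr = subst (d + r <_) (trans (+-suc d a) (cong suc (+-comm d a))) (+-monoʳ-< d rl)
    posσ : a + suc b + r ≡ a′ + suc b′ + (d + r)
    posσ = lem a d b′ r
      where lem : ∀ a d b′ r → a + suc (b′ + (d + d)) + r ≡ a + d + suc b′ + (d + r)
            lem = solve-∀
    zpos : ix α′ (a + suc bγ + r) ≡ ix α′ (m′ + (d + r))
    zpos = cong (ix α′) (Tpos r)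
    eqT : ix S1.σ (a + suc b + r) ≡ ix S2.σ (a′ + suc b′ + (d + r))
    eqT = trans (eqix _) (cong (ix S2.σ) posσ)
    body : _
    body with S1.vT r rl | S2.vT (d + r) dr
    ... | inj₂ (ne , e1) | inj₂ (_ , e2) = (λ _ → trans zpos (trans (sym e2) (trans (sym eqT) e1))) , (λ e → ⊥-elim (ne e))
    ... | inj₂ (ne , e1) | inj₁ (_ , e2) = ⊥-elim (<⇒≱ (≤-trans (s≤s (m≤m+n a d)) (proj₁ (S2.mTS e2))) (subst (_≤ a) eqT (proj₂ (S1.lTL r rl ne e1))))
    ... | inj₁ (t1 , _) | inj₁ (t2 , _) = (λ ne → ⊥-elim (ne t1)) , (λ _ → subst (a <_) (sym (trans zpos t2)) a<m′)
    ... | inj₁ (t1 , e1) | inj₂ (_ , e2) = (λ ne → ⊥-elim (ne t1)) ,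
           (λ _ → subst (a <_) (trans (trans eqT e2) (sym zpos)) (proj₁ (S1.mTS e1)))

  lowerToBlock : ℕ → ℕ
  lowerToBlock y with a + suc bγ <? y
  ... | yes _ = nγ
  ... | no  _ = y ∸ a

  z0 = ix α′ (a + suc bγ + r0)

  g : ℕ → ℕ
  g q with q <? suc bγ
  ... | yes _ = lowerToBlock (ix α′ (a + q))
  ... | no  _ = z0 ∸ a

  γ : List ℕ
  γ = map g (upTo nγ)

  Lγ : length γ ≡ nγ
  Lγ = trans (length-map g (upTo nγ)) (length-upTo nγ)

  ixγ : ∀ q → q < nγ → ix γ q ≡ g q
  ixγ q ql = trans (ix-map g (upTo nγ) q (subst (q <_) (sym (length-upTo nγ)) ql)) (cong g (ix-applyUpTo (λ x → x) nγ q ql))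

  gB : ∀ q → q < suc bγ → g q ≡ lowerToBlock (ix α′ (a + q))
  gB q ql with q <? suc bγ
  ... | yes _ = refl
  ... | no x = ⊥-elim (x ql)

  gL : g (suc bγ) ≡ z0 ∸ a
  gL with suc bγ <? suc bγ
  ... | yes x = ⊥-elim (<-irrefl refl x)
  ... | no _ = refl

  module S3 = Star a bγ α γ S1.Lα Lγ

  S3βb-n : S3.βb nγ ≡ ix α a + bγ
  S3βb-n rewrite ≡ᵇ-refl nγ = refl
  S3βb-ne : ∀ w → w ≢ nγ → S3.βb w ≡ w + a
  S3βb-ne w ne rewrite ≡ᵇ-false w nγ ne = refl
  S3αb-m : S3.αb m ≡ ix γ (suc bγ) + a
  S3αb-m rewrite ≡ᵇ-refl m = refl
  S3αb-ne : ∀ x → x ≢ m → S3.αb x ≡ x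
  S3αb-ne x ne rewrite ≡ᵇ-false x m ne = refl

  γlast : ix γ (suc bγ) ≡ z0 ∸ a
  γlast = trans (ixγ (suc bγ) ≤-refl) gL

  z0>a : a < z0
  z0>a = proj₂ (Tfact r0 r0l) αr0

  blockval : ∀ q → q < suc bγ → S3.βb (ix γ q) ≡ ix α′ (a + q)
  blockval q ql = trans (cong S3.βb (trans (ixγ q (m≤n⇒m≤1+n ql)) (gB q ql))) (cv (ix α′ (a + q)) (blockEntry q ql))
    where
    cv : ∀ y → BlockEntry y → S3.βb (lowerToBlock y) ≡ y
    cv y (gt , B2) with a + suc bγ <? y
    ... | yes hi = trans S3βb-n (sym (B2 hi))
    ... | no nhi = trans (S3βb-ne (y ∸ a) ne) (m∸n+n≡m (<⇒≤ gt))
      where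
      le : y ∸ a ≤ suc bγ
      le = subst (y ∸ a ≤_) (m+n∸m≡n a (suc bγ)) (∸-monoˡ-≤ a (≮⇒≥ nhi))
      ne : y ∸ a ≢ nγ
      ne e = <⇒≱ (s≤s ≤-refl) (subst (_≤ suc bγ) e le)

  α′≡ : S3.σ ≡ α′
  α′≡ = ix-ext S3.σ α′ (trans S3.lenσ (trans (lemL a d) (sym S2.Lα))) h
    where
    lemL : ∀ a d → a + suc (d + d) + suc a ≡ suc (a + d) + suc (a + d)
    lemL = solve-∀
    h : ∀ i → i < length S3.σ → ix S3.σ i ≡ ix α′ i
    h i il with S3.cls i (subst (i <_) S3.lenσ il)
    ... | S3.cP p pl refl = trans (S3.ixP p pl) (sym (pre′ p pl))
    ... | S3.cB q ql refl = trans (S3.ixB q ql) (blockval q ql)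
    ... | S3.cT r rl refl with ix α (m + r) ≟ m
    ...   | yes e = trans (S3.ixT r rl) (trans (cong S3.αb e) (trans S3αb-m (trans (cong (_+ a) γlast)
               (trans (m∸n+n≡m (<⇒≤ z0>a)) (cong (λ k → ix α′ (a + suc bγ + k)) (sym (r0-uniq r rl e)))))))
    ...   | no ne = trans (S3.ixT r rl) (trans (S3αb-ne _ ne) (sym (proj₁ (Tfact r rl) ne)))

  dr0 : d + r0 < suc a′
  dr0 = subst (d + r0 <_) (trans (+-suc d a) (cong suc (+-comm d a))) (+-monoʳ-< d r0l)

  z0≤ : z0 ≤ m′
  z0≤ = subst (_≤ m′) (cong (ix α′) (sym (Tpos r0))) (proj₂ (S2.αTl (d + r0) dr0))

  γL-bd : 1 ≤ ix γ (suc bγ) × ix γ (suc bγ) ≤ suc bγ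
  γL-bd = subst (λ w → 1 ≤ w × w ≤ suc bγ) (sym γlast)
    (m<n⇒0<n∸m z0>a , ≤-trans (∸-monoˡ-≤ a z0≤) (subst (_≤ suc bγ) (sym (trans (+-∸-assoc 1 (m≤m+n a d)) (cong suc (m+n∸m≡n a d)))) (s≤s (m≤m+n d d))))

  Lpos = a + suc bγ + r0
  vL : ix α′ Lpos ≡ ix γ (suc bγ) + a
  vL = trans (sym (m∸n+n≡m (<⇒≤ z0>a))) (cong (_+ a) (sym γlast))

  γview : ∀ q → q < suc bγ → (ix γ q ≡ nγ × ix α′ (a + q) ≡ ix α a + bγ) ⊎ ((1 ≤ ix γ q × ix γ q ≤ suc bγ) × ix α′ (a + q) ≡ ix γ q + a)
  γview q ql = body (ix α′ (a + q)) (blockEntry q ql) (trans (ixγ q (m≤n⇒m≤1+n ql)) (gB q ql))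
    where
    body : ∀ y → BlockEntry y → ix γ q ≡ lowerToBlock y → (ix γ q ≡ nγ × y ≡ ix α a + bγ) ⊎ ((1 ≤ ix γ q × ix γ q ≤ suc bγ) × y ≡ ix γ q + a)
    body y (gt , B2) e with a + suc bγ <? y
    ... | yes hi = inj₁ (e , B2 hi)
    ... | no nhi = inj₂ (subst (λ w → 1 ≤ w × w ≤ suc bγ) (sym e) (m<n⇒0<n∸m gt , subst (y ∸ a ≤_) (m+n∸m≡n a (suc bγ)) (∸-monoˡ-≤ a (≮⇒≥ nhi))) ,
                        trans (sym (m∸n+n≡m (<⇒≤ gt))) (cong (_+ a) (sym e)))

  γPerm : IsPerm nγ γ
  γPerm = injective⇒IsPerm nγ γ Lγ R I
    where
    R : ∀ q → q < nγ → 1 ≤ ix γ q × ix γ q ≤ nγ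
    R q ql with q <? suc bγ
    ... | no nq = subst (λ k → 1 ≤ ix γ k × ix γ k ≤ nγ) (sym (≤-antisym (≤-pred ql) (≮⇒≥ nq))) (proj₁ γL-bd , m≤n⇒m≤1+n (proj₂ γL-bd))
    ... | yes bq with γview q bq
    ...   | inj₁ (e , _) = subst (λ w → 1 ≤ w × w ≤ nγ) (sym e) (s≤s z≤n , ≤-refl)
    ...   | inj₂ ((l , u) , _) = l , m≤n⇒m≤1+n u
    posB : ∀ q → q < suc bγ → a + q < suc a′ + suc a′
    posB q ql = ≤-trans (+-monoʳ-< a ql) (≤-trans (m≤m+n (a + suc bγ) (suc a)) (≤-reflexive (lem a d)))
      where lem : ∀ a d → a + suc (d + d) + suc a ≡ suc (a + d) + suc (a + d)
            lem = solve-∀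
    posL : Lpos < suc a′ + suc a′
    posL = subst (_< suc a′ + suc a′) (sym (Tpos r0)) (+-monoʳ-< m′ dr0)
    blk≠L : ∀ q → q < suc bγ → a + q ≢ Lpos
    blk≠L q ql e = <⇒≢ (≤-trans (+-monoʳ-< a ql) (m≤m+n (a + suc bγ) r0)) e
    bl-last : ∀ q → q < suc bγ → ix γ q ≡ ix γ (suc bγ) → ⊥
    bl-last q ql e with γview q ql
    ... | inj₁ (g1 , _) = <⇒≱ (s≤s ≤-refl) (subst (_≤ suc bγ) (trans (sym e) g1) (proj₂ γL-bd))
    ... | inj₂ (_ , v1) = blk≠L q ql (inj S2.Pα (a + q) Lpos (posB q ql) posL (trans v1 (trans (cong (_+ a) e) (sym vL))))
    I : ∀ q q′ → q < nγ → q′ < nγ → ix γ q ≡ ix γ q′ → q ≡ q′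
    I q q′ ql ql′ e with q <? suc bγ | q′ <? suc bγ
    ... | yes bq | yes bq′ = +-cancelˡ-≡ a _ _ (inj S2.Pα (a + q) (a + q′) (posB q bq) (posB q′ bq′)
            (trans (sym (blockval q bq)) (trans (cong S3.βb e) (blockval q′ bq′))))
    ... | no nq | no nq′ = trans (≤-antisym (≤-pred ql) (≮⇒≥ nq)) (sym (≤-antisym (≤-pred ql′) (≮⇒≥ nq′)))
    ... | yes bq | no nq′ = ⊥-elim (bl-last q bq (trans e (cong (ix γ) (≤-antisym (≤-pred ql′) (≮⇒≥ nq′)))))
    ... | no nq | yes bq′ = ⊥-elim (bl-last q′ bq′ (trans (sym e) (cong (ix γ) (≤-antisym (≤-pred ql) (≮⇒≥ nq)))))

  module Cyclic (a1 : 1 ≤ a) where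
    N′ = suc a′ + suc a′
    CP′ : OrbitInduction N′ (at α′)
    CP′ = isNCycle⇒OrbitInduction S2.Pα (InA′.cy fα′) (s≤s z≤n)

    lemN : a + suc bγ + suc a ≡ N′
    lemN = lem a d
      where lem : ∀ a d → a + suc (d + d) + suc a ≡ suc (a + d) + suc (a + d)
            lem = solve-∀

    Rγ : ℕ → Set
    Rγ y = ∃ λ t → iter (at γ) t 1 ≡ y
    stepγ : ∀ {v} → Rγ v → Rγ (at γ v)
    stepγ (t , e) = suc t , trans (iter-suc (at γ) t 1) (cong (at γ) e)

    Blk : ℕ → Set
    Blk v = a < v × v ≤ a + suc bγ

    Q : ℕ → Set
    Q v = (Blk v → Rγ (v ∸ a)) × (¬ Blk v → Rγ nγ)

    S3l : ∀ i → i < N′ → i < S3.N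
    S3l i il = subst (i <_) (sym lemN) il

    hiγ : ∀ x → suc a < x → a + suc bγ < x + bγ
    hiγ x l = subst (_≤ x + bγ) (cong suc (sym (+-suc a bγ))) (+-monoˡ-≤ bγ l)

    hiNB : ∀ v → a + suc bγ < v → ¬ Blk v
    hiNB v h (_ , u) = <⇒≱ h u

    clQ : ∀ v → InRange N′ v → Q v → Q (at α′ v)
    clQ (suc i) (_ , il) (q1 , q2) with S3.cls i (S3l i il)
    ... | S3.cP p pl refl =
        let e : at α′ (suc p) ≡ ix α p + bγ
            e = trans (at-suc α′ p) (pre′ p pl)
            hi : a + suc bγ < at α′ (suc p)
            hi = subst (a + suc bγ <_) (sym e) (hiγ _ (proj₁ (S1.αPre p (m≤n⇒m≤1+n pl))))
            nb : ¬ Blk (suc p)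
            nb (x , _) = <⇒≱ pl (≤-pred x)
        in (λ b → ⊥-elim (hiNB _ hi b)) , (λ _ → q2 nb)
    ... | S3.cB q ql refl = body
      where
      av : at α′ (suc (a + q)) ≡ ix α′ (a + q)
      av = at-suc α′ (a + q)
      bk : Blk (suc (a + q))
      bk = s≤s (m≤m+n a q) , subst (suc (a + q) ≤_) (sym (+-suc a bγ)) (s≤s (+-monoʳ-≤ a (≤-pred ql)))
      Rq : Rγ (suc q)
      Rq = subst Rγ (trans (cong (_∸ a) (sym (+-suc a q))) (m+n∸m≡n a (suc q))) (q1 bk)
      Rgq : Rγ (ix γ q)
      Rgq = subst Rγ (at-suc γ q) (stepγ Rq)
      body : Q (at α′ (suc (a + q)))
      body with γview q ql
      ... | inj₁ (g1 , e) = let hi = subst (a + suc bγ <_) (sym (trans av e)) (hiγ _ (proj₁ (S1.αPre a ≤-refl))) in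
            (λ b → ⊥-elim (hiNB _ hi b)) , (λ _ → subst Rγ g1 Rgq)
      ... | inj₂ ((l , u) , e) = let e′ = trans av e in
            (λ _ → subst Rγ (sym (trans (cong (_∸ a) e′) (m+n∸n≡m (ix γ q) a))) Rgq) ,
            (λ nb → ⊥-elim (nb (subst Blk (sym e′) (+-monoˡ-≤ a l ,
                                 subst (ix γ q + a ≤_) (+-comm (suc bγ) a) (+-monoˡ-≤ a u)))))
    ... | S3.cT r rl refl = body
      where
      av : at α′ (suc (a + suc bγ + r)) ≡ ix α′ (a + suc bγ + r)
      av = at-suc α′ _
      nb : ¬ Blk (suc (a + suc bγ + r))
      nb (_ , u) = <⇒≱ (s≤s (m≤m+n (a + suc bγ) r)) u
      Rn : Rγ nγ
      Rn = q2 nb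
      body : Q (at α′ (suc (a + suc bγ + r)))
      body with ix α (m + r) ≟ m
      ... | yes e = let rr = r0-uniq r rl e
                        e′ : at α′ (suc (a + suc bγ + r)) ≡ ix γ (suc bγ) + a
                        e′ = trans av (trans (cong (λ k → ix α′ (a + suc bγ + k)) rr) vL) in
            (λ _ → subst Rγ (sym (trans (cong (_∸ a) e′) (m+n∸n≡m _ a))) (subst Rγ (at-suc γ (suc bγ)) (stepγ Rn))) ,
            (λ nb′ → ⊥-elim (nb′ (subst Blk (sym e′) (+-monoˡ-≤ a (proj₁ γL-bd) ,
                                 subst (ix γ (suc bγ) + a ≤_) (+-comm (suc bγ) a) (+-monoˡ-≤ a (proj₂ γL-bd))))))
      ... | no ne = let e′ = trans av (proj₁ (Tfact r rl) ne) in
            (λ b → ⊥-elim (<⇒≱ (proj₁ b) (subst (_≤ a) (sym e′) (proj₂ (S1.loV r rl ne))))) , (λ _ → Rn)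

    Qst : Q (suc a)
    Qst = (λ _ → subst Rγ (sym (sa∸a a)) (0 , refl)) , (λ nb → ⊥-elim (nb (≤-refl , subst (suc a ≤_) (sym (+-suc a bγ)) (s≤s (m≤m+n a bγ)))))
      where sa∸a : ∀ a → suc a ∸ a ≡ 1
            sa∸a zero = refl
            sa∸a (suc a) = sa∸a a

    allQ : ∀ v → InRange N′ v → Q v
    allQ = CP′ Q clQ (suc a) (s≤s z≤n , ≤-trans (s≤s (m≤m+n a d)) (m≤m+n m′ m′)) Qst

    γreach : ∀ y → InRange nγ y → Rγ y
    γreach y (y1 , yn) with y ≟ nγ
    ... | yes refl = proj₂ (allQ 1 (≤-refl , s≤s z≤n)) (λ b → <⇒≱ (proj₁ b) a1)
    ... | no ne = subst Rγ (m+n∸n≡m y a) (proj₁ (allQ (y + a) (≤-trans y1 (m≤m+n y a) , ≤-trans (+-monoˡ-≤ a yn′) (≤-trans (≤-reflexive (+-comm (suc bγ) a)) (≤-trans (m≤m+n (a + suc bγ) (suc a)) (≤-reflexive lemN)))))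
                 (+-monoˡ-≤ a y1 , subst (y + a ≤_) (+-comm (suc bγ) a) (+-monoˡ-≤ a yn′)))
      where yn′ : y ≤ suc bγ
            yn′ = ≤-pred (≤∧≢⇒< yn ne)

    γcyc : isNCycle nγ γ ≡ true
    γcyc = reachable⇒isNCycle nγ γ γreach

    posγ : ℕ → ℕ
    posγ q with q <? suc bγ
    ... | yes _ = a + q
    ... | no  _ = Lpos

    valγ : ∀ q → q < nγ → ix α′ (posγ q) ≡ S3.βb (ix γ q)
    valγ q ql with q <? suc bγ
    ... | yes bq = sym (blockval q bq)
    ... | no nq with ≤-antisym (≤-pred ql) (≮⇒≥ nq)
    ...   | refl = trans vL (sym (S3βb-ne _ (λ e → <⇒≱ (s≤s ≤-refl) (subst (_≤ suc bγ) e (proj₂ γL-bd)))))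

    posγ-mono : ∀ q q′ → q < q′ → q′ < nγ → posγ q < posγ q′
    posγ-mono q q′ lt ql′ with q <? suc bγ | q′ <? suc bγ
    ... | yes _ | yes _ = +-monoʳ-< a lt
    ... | yes bq | no _ = ≤-trans (+-monoʳ-< a bq) (m≤m+n (a + suc bγ) r0)
    ... | no nq | _ = ⊥-elim (<⇒≱ (<-≤-trans lt (≤-pred ql′)) (≮⇒≥ nq))

    posγ-bd : ∀ q → q < nγ → posγ q < N′
    posγ-bd q ql with q <? suc bγ
    ... | yes bq = subst (a + q <_) lemN (≤-trans (+-monoʳ-< a bq) (m≤m+n (a + suc bγ) (suc a)))
    ... | no _ = subst (_< N′) (sym (Tpos r0)) (+-monoʳ-< m′ dr0)

    βb-mono : ∀ w w′ → w < w′ → w′ ≤ nγ → S3.βb w < S3.βb w′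
    βb-mono w w′ lt le with w′ ≟ nγ
    ... | yes refl = subst₂ _<_ (sym (S3βb-ne w (<⇒≢ lt))) (sym S3βb-n)
                       (<-≤-trans (s≤s (subst (w + a ≤_) (+-comm (suc bγ) a) (+-monoˡ-≤ a (≤-pred lt)))) (hiγ _ (proj₁ (S1.αPre a ≤-refl))))
    ... | no ne = subst₂ _<_ (sym (S3βb-ne w (λ e → <⇒≱ (<-≤-trans lt le) (≤-reflexive (sym e))))) (sym (S3βb-ne w′ ne)) (+-monoˡ-< a lt)

    γavoid : Avoids132 γ
    γavoid q1 q2 q3 l12 l23 l3 p q = InA′.av fα′ (posγ q1) (posγ q2) (posγ q3) (posγ-mono q1 q2 l12 l2) (posγ-mono q2 q3 l23 l3′)
        (subst (posγ q3 <_) (sym S2.Lα) (posγ-bd q3 l3′))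
        (subst₂ _<_ (sym (valγ q1 l1)) (sym (valγ q3 l3′)) (βb-mono _ _ p (proj₂ (rng γPerm q3 l3′))))
        (subst₂ _<_ (sym (valγ q3 l3′)) (sym (valγ q2 l2)) (βb-mono _ _ q (proj₂ (rng γPerm q2 l2))))
      where
      l3′ = subst (q3 <_) Lγ l3
      l2 = <-trans l23 l3′
      l1 = <-trans l12 l2

    γC : γ ∈ C nγ
    γC = ∈C⁺ γPerm γcyc (Avoids132⇒avoids132 γ γavoid)

star-Cycle132 : ∀ {a b α β} → 1 ≤ a → InA′ a α → Cycle132 (suc (suc b)) β →
                Cycle132 (a + suc b + suc a) (star (suc a) (suc (suc b)) α β)
star-Cycle132 {a} {b} {α} {β} a1 fα fβ = record { P = StarSetting.σPerm a b α β fα fβ ; cy = CS.σcyc a1 ; av = StarAvoids.σavoid a b α β fα fβ }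
  where module CS = StarCycle a b α β fα fβ

star-inj : ∀ {a b α β α′ β′} → InA′ a α → Cycle132 (suc (suc b)) β → InA′ a α′ → Cycle132 (suc (suc b)) β′ →
           star (suc a) (suc (suc b)) α β ≡ star (suc a) (suc (suc b)) α′ β′ → α ≡ α′ × β ≡ β′
star-inj {a} {b} {α} {β} {α′} {β′} fα fβ fα′ fβ′ e = I.αeq , I.βeq
  where module I = StarInjective a b α β α′ β′ fα fβ fα′ fβ′ e

star-HighThenLow : ∀ {a c α β} → InA′ a α → Cycle132 (suc (suc (c + c))) β →
                   HighThenLow (suc c) β → HighThenLow (a + suc c) (star (suc a) (suc (suc (c + c))) α β)
star-HighThenLow {a} {c} {α} {β} fα fβ = StarHighThenLow.star-preserves-HighThenLow a c α β fα fβ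

star-HighThenLow⁻ : ∀ {a c α β} → InA′ a α → Cycle132 (suc (suc (c + c))) β →
                    HighThenLow (a + suc c) (star (suc a) (suc (suc (c + c))) α β) → HighThenLow (suc c) β
star-HighThenLow⁻ {a} {c} {α} {β} fα fβ = StarHighThenLow.star-reflects-HighThenLow a c α β fα fβ

-- Counting X_{k,n} and A′ₖ

A′-1 : A′ 1 ≡ (3 ∷ 4 ∷ 2 ∷ 1 ∷ []) ∷ (4 ∷ 3 ∷ 1 ∷ 2 ∷ []) ∷ []
A′-1 = refl

A⊆A′ : ∀ k {α} → 1 ≤ k → α ∈ A k → α ∈ A′ k
A⊆A′ (suc zero) _ (here refl) = subst ((4 ∷ 3 ∷ 1 ∷ 2 ∷ []) ∈_) (sym A′-1) (there (here refl))
A⊆A′ (suc zero) _ (there (here refl)) = subst ((3 ∷ 4 ∷ 2 ∷ 1 ∷ []) ∈_) (sym A′-1) (here refl)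
A⊆A′ (suc (suc k)) _ m = proj₁ (∈-filterᵇ⁻ _ (A′ (suc (suc k))) m)

Unique-A′ : ∀ k → Unique (A′ k)
Unique-A′ k = UP.filter⁺ _ (Unique-C (2 * k + 2))

Unique-A : ∀ k → Unique (A k)
Unique-A zero = []
Unique-A (suc zero) = ((λ ()) ∷ []) ∷ [] ∷ []
Unique-A (suc (suc k)) = UP.filter⁺ _ (Unique-A′ (suc (suc k)))

-- X k n is definitionally starProduct k (n ∸ 2 * k) (A k) (C (n ∸ 2 * k)).
starProduct : ℕ → ℕ → List Perm → List Perm → List Perm
starProduct k n as bs = concatMap (λ α → map (star (suc k) n α) bs) as

∈starProduct⁻ : ∀ {k n as bs z} → z ∈ starProduct k n as bs →
                ∃ λ α → ∃ λ β → α ∈ as × β ∈ bs × z ≡ star (suc k) n α β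
∈starProduct⁻ {as = as} z∈ with ∈-concatMap⁻ _ as z∈
... | α , α∈ , z∈′ with ∈-map⁻ _ z∈′
...   | β , β∈ , e = α , β , α∈ , β∈ , e

∈starProduct⁺ : ∀ {k n as bs α β} → α ∈ as → β ∈ bs → star (suc k) n α β ∈ starProduct k n as bs
∈starProduct⁺ {as = as} α∈ β∈ = ∈-concatMap⁺ _ as α∈ (∈-map⁺ _ β∈)

length-starProduct : ∀ k n as bs → length (starProduct k n as bs) ≡ length as * length bs
length-starProduct k n []       bs = refl
length-starProduct k n (α ∷ as) bs =
  trans (length-++ (map (star (suc k) n α) bs)) (cong₂ _+_ (length-map _ bs) (length-starProduct k n as bs))

module _ {k b : ℕ} {as bs : List Perm} (fA : ∀ {α} → α ∈ as → InA′ k α) (fB : ∀ {β} → β ∈ bs → Cycle132 (suc (suc b)) β)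
         (uA : Unique as) (uB : Unique bs) where

  Unique-starProduct : Unique (starProduct k (suc (suc b)) as bs)
  Unique-starProduct = Unique-concatMap _ as uA
    (λ α∈ → Unique-map _ bs uB (λ β∈ β′∈ e → proj₂ (star-inj (fA α∈) (fB β∈) (fA α∈) (fB β′∈) e)))
    (λ α∈ α′∈ z∈ z∈′ → let (β , β∈ , e) = ∈-map⁻ _ z∈ ; (β′ , β′∈ , e′) = ∈-map⁻ _ z∈′ in
       proj₁ (star-inj (fA α∈) (fB β∈) (fA α′∈) (fB β′∈) (trans (sym e) e′)))

  ∣starProduct∣ : ∣ starProduct k (suc (suc b)) as bs ∣ ≡ ∣ as ∣ * ∣ bs ∣
  ∣starProduct∣ = begin
    ∣ starProduct k (suc (suc b)) as bs ∣      ≡⟨ Unique⇒∣∣≡length _ Unique-starProduct ⟩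
    length (starProduct k (suc (suc b)) as bs) ≡⟨ length-starProduct k (suc (suc b)) as bs ⟩
    length as * length bs                      ≡⟨ cong₂ _*_ (sym (Unique⇒∣∣≡length as uA)) (sym (Unique⇒∣∣≡length bs uB)) ⟩
    ∣ as ∣ * ∣ bs ∣                              ∎
    where open ≡-Reasoning

∈A⇒InA′ : ∀ {k α} → 1 ≤ k → α ∈ A k → InA′ k α
∈A⇒InA′ k1 α∈ = ∈A′⇒InA′ (A⊆A′ _ k1 α∈)

2≤m⇒m≡2+[m∸2] : ∀ {m} → 2 ≤ m → m ≡ suc (suc (m ∸ 2))
2≤m⇒m≡2+[m∸2] (s≤s (s≤s _)) = refl

∣X∣≡∣A∣*c : ∀ k → 1 ≤ k → ∀ n → 2 * k + 2 ≤ n → ∣ X k n ∣ ≡ ∣ A k ∣ * c (n ∸ 2 * k)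
∣X∣≡∣A∣*c k k1 n le = subst (λ m → ∣ starProduct k m (A k) (C m) ∣ ≡ ∣ A k ∣ * c m) (sym n∸2k≡2+b)
  (∣starProduct∣ (∈A⇒InA′ k1) ∈C⇒Cycle132 (Unique-A k) (Unique-C (suc (suc (n ∸ 2 * k ∸ 2)))))
  where
  n∸2k≡2+b : n ∸ 2 * k ≡ suc (suc (n ∸ 2 * k ∸ 2))
  n∸2k≡2+b = 2≤m⇒m≡2+[m∸2] (m+n≤o⇒m≤o∸n 2 (subst (_≤ n) (+-comm (2 * k) 2) le))

memb⇒∈ : ∀ σ xs → memb σ xs ≡ true → σ ∈ xs
memb⇒∈ σ xs e with any-true⇒ (λ τ → does (LP.≡-dec _≟_ σ τ)) xs e
... | τ , τ∈ , d with LP.≡-dec _≟_ σ τ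
... | yes refl = τ∈

∈⇒memb : ∀ σ xs → σ ∈ xs → memb σ xs ≡ true
∈⇒memb σ xs m = any-⇒true (λ τ → does (LP.≡-dec _≟_ σ τ)) xs m (dec-true (LP.≡-dec _≟_ σ σ) refl)

X⊆XU : ∀ j i N {z} → 1 ≤ i → i ≤ j → z ∈ X i N → z ∈ XU j N
X⊆XU (suc j) i N k1 le m with i ≟ suc j
... | yes refl = ∈-++⁺ʳ (XU j N) m
... | no ne = ∈-++⁺ˡ (X⊆XU j i N k1 (≤-pred (≤∧≢⇒< le ne)) m)
X⊆XU zero (suc i) N k1 () m

XU⊆X : ∀ j N {z} → z ∈ XU j N → ∃ λ i → 1 ≤ i × i ≤ j × z ∈ X i N
XU⊆X (suc j) N m with ∈-++⁻ (XU j N) m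
... | inj₁ m′ = let (i , a , b , c) = XU⊆X j N m′ in i , a , m≤n⇒m≤1+n b , c
... | inj₂ m′ = suc j , s≤s z≤n , ≤-refl , m′

A-excludes-X : ∀ k′ α → α ∈ A (suc (suc k′)) → ∀ j → 1 ≤ j → j ≤ suc k′ → α ∈ X j (2 * suc (suc k′) + 2) → ⊥
A-excludes-X k′ α m j j1 jK mx =
  let (_ , pf) = ∈-filterᵇ⁻ _ (A′ (suc (suc k′))) m in
  true≢false (trans (sym pf) (cong not (∈⇒memb α _ (X⊆XU (suc k′) j _ j1 jK mx))))

2[i+c]+2∸2i : ∀ i c → 2 * (i + c) + 2 ∸ 2 * i ≡ suc (suc (c + c))
2[i+c]+2∸2i i c = trans (cong (_∸ 2 * i) (lem i c)) (m+n∸m≡n (2 * i) (suc (suc (c + c))))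
  where lem : ∀ i c → 2 * (i + c) + 2 ≡ 2 * i + suc (suc (c + c))
        lem = solve-∀

star∈A′ : ∀ {i c α β} → 1 ≤ i → InA′ i α → InA′ c β → star (suc i) (suc (suc (c + c))) α β ∈ A′ (i + c)
star∈A′ {i} {c} {α} {β} i1 fα fβ = InA′⇒∈A′ (i + c) σ record
  { P = subst (λ w → IsPerm w σ) len≡ (Cycle132.P cf)
  ; H = subst (λ w → HighThenLow w σ) (+-suc i c) (star-HighThenLow fα (InA′⇒Cycle132 fβ) (InA′.H fβ))
  ; cy = subst (λ w → isNCycle w σ ≡ true) len≡ (Cycle132.cy cf)
  ; av = Cycle132.av cf }
  where
  σ = star (suc i) (suc (suc (c + c))) α β
  cf = star-Cycle132 i1 fα (InA′⇒Cycle132 fβ)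
  len≡ : i + suc (c + c) + suc i ≡ suc (i + c) + suc (i + c)
  len≡ = lem i c
    where lem : ∀ i c → i + suc (c + c) + suc i ≡ suc (i + c) + suc (i + c)
          lem = solve-∀

star∈A′⁻ : ∀ {i c α β} → InA′ i α → β ∈ C (suc (suc (c + c))) →
           star (suc i) (suc (suc (c + c))) α β ∈ A′ (i + c) → β ∈ A′ c
star∈A′⁻ {i} {c} {α} {β} fα β∈ σ∈ = ∈A′⁺ c β (subst (λ w → β ∈ C w) (sym (trans (2k+2≡ c) (cong suc (+-suc c c)))) β∈)
  (star-HighThenLow⁻ fα (∈C⇒Cycle132 β∈) (subst (λ w → HighThenLow w (star (suc i) (suc (suc (c + c))) α β)) (sym (+-suc i c)) (InA′.H (∈A′⇒InA′ {i + c} σ∈))))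

starAA′ : ℕ → ℕ → List Perm
starAA′ i c = starProduct i (suc (suc (c + c))) (A i) (A′ c)

∈starAA′⁻ : ∀ i c {z} → 1 ≤ i → z ∈ starAA′ i c → z ∈ A′ (i + c) × z ∈ X i (2 * (i + c) + 2)
∈starAA′⁻ i c {z} i1 z∈ with ∈starProduct⁻ {i} {as = A i} {A′ c} z∈
... | α , β , α∈ , β∈ , refl =
  star∈A′ i1 (∈A⇒InA′ i1 α∈) (∈A′⇒InA′ {c} β∈) ,
  subst (λ w → star (suc i) w α β ∈ X i (2 * (i + c) + 2)) (2[i+c]+2∸2i i c)
    (∈starProduct⁺ {i} {as = A i} α∈ (subst (λ w → β ∈ C w) (sym (2[i+c]+2∸2i i c)) (Cycle132⇒∈C (InA′⇒Cycle132 {c} (∈A′⇒InA′ β∈)))))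

∈starAA′⁺ : ∀ i c {z} → 1 ≤ i → z ∈ A′ (i + c) → z ∈ X i (2 * (i + c) + 2) → z ∈ starAA′ i c
∈starAA′⁺ i c {z} i1 zA zX with ∈starProduct⁻ {i} {as = A i} {C (2 * (i + c) + 2 ∸ 2 * i)} zX
... | α , β , α∈ , β∈ , refl = subst (_∈ starAA′ i c) (cong (λ w → star (suc i) w α β) (sym (2[i+c]+2∸2i i c)))
  (∈starProduct⁺ {i} {as = A i} α∈ (star∈A′⁻ (∈A⇒InA′ i1 α∈) β∈′
    (subst (λ w → star (suc i) w α β ∈ A′ (i + c)) (2[i+c]+2∸2i i c) zA)))
  where
  β∈′ : β ∈ C (suc (suc (c + c)))
  β∈′ = subst (λ w → β ∈ C w) (2[i+c]+2∸2i i c) β∈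

A-X-disjoint : ∀ a d c′ {α β α′ β′} → 1 ≤ a → 1 ≤ d → α ∈ A a → β ∈ A′ (c′ + d) → α′ ∈ A (a + d) → β′ ∈ A′ c′ →
  star (suc a) (suc (suc ((c′ + d) + (c′ + d)))) α β ≡ star (suc (a + d)) (suc (suc (c′ + c′))) α′ β′ → ⊥
A-X-disjoint (suc a₀) (suc d₀) c′ {α} {β} {α′} {β′} a1 d1 α∈ β∈ α′∈ β′∈ eq =
  A-excludes-X (a₀ + d₀) α′ (subst (λ z → α′ ∈ A z) ad α′∈) a (s≤s z≤n) (s≤s (m≤m+n a₀ d₀))
    (subst (λ z → α′ ∈ X a (2 * z + 2)) ad α′∈X)
  where
  a = suc a₀
  d = suc d₀
  b′ = c′ + c′
  E : (c′ + d) + (c′ + d) ≡ b′ + (d + d)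
  E = lem c′ d
    where lem : ∀ c d → (c + d) + (c + d) ≡ (c + c) + (d + d)
          lem = solve-∀
  ad : a + d ≡ suc (suc (a₀ + d₀))
  ad = cong suc (+-suc a₀ d₀)
  fα = ∈A⇒InA′ a1 α∈
  fα′ = ∈A⇒InA′ (≤-trans a1 (m≤m+n a d)) α′∈
  fβ : Cycle132 (suc (suc (b′ + (d + d)))) β
  fβ = subst (λ z → Cycle132 (suc (suc z)) β) E (InA′⇒Cycle132 {c′ + d} (∈A′⇒InA′ β∈))
  fβ′ = InA′⇒Cycle132 {c′} (∈A′⇒InA′ β′∈)
  eq′ : star (suc a) (suc (suc (b′ + (d + d)))) α β ≡ star (suc (a + d)) (suc (suc b′)) α′ β′
  eq′ = subst (λ z → star (suc a) (suc (suc z)) α β ≡ star (suc (a + d)) (suc (suc b′)) α′ β′) E eq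
  module D = StarFactor a d b′ α β α′ β′ fα fβ fα′ fβ′ eq′
  module G = D.Cyclic a1
  α′∈X : α′ ∈ X a (2 * (a + d) + 2)
  α′∈X = subst (_∈ X a (2 * (a + d) + 2)) (trans (cong (λ z → star (suc a) z α D.γ) (2[i+c]+2∸2i a d)) D.α′≡)
           (∈starProduct⁺ {a} {as = A a} α∈ (subst (λ z → D.γ ∈ C z) (sym (2[i+c]+2∸2i a d)) G.γC))

module Recurrence (k′ : ℕ) where
  K = suc (suc k′)

  indices : List ℕ
  indices = map suc (upTo (suc k′))

  notInXU : Perm → Bool
  notInXU α = not (memb α (XU (suc k′) (2 * K + 2)))

  decomposition : List Perm
  decomposition = concatMap (λ i → starAA′ i (K ∸ i)) indices

  ∈indices⁻ : ∀ {i} → i ∈ indices → 1 ≤ i × i ≤ suc k′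
  ∈indices⁻ m with ∈-map⁻ suc m
  ... | j , j∈ , refl = s≤s z≤n , ∈-upTo⁻ j∈

  ∈indices⁺ : ∀ {i} → 1 ≤ i → i ≤ suc k′ → i ∈ indices
  ∈indices⁺ {suc j} _ le = ∈-map⁺ suc (∈-upTo⁺ le)

  i+[K∸i]≡K : ∀ i → i ≤ suc k′ → i + (K ∸ i) ≡ K
  i+[K∸i]≡K i le = m+[n∸m]≡n (m≤n⇒m≤1+n le)

  length-decomposition : length decomposition ≡ sum (map (λ i → ∣ A i ∣ * ∣ A′ (K ∸ i) ∣) indices)
  length-decomposition = trans (length-concatMap (λ i → starAA′ i (K ∸ i)) indices)
    (cong sum (map-cong (λ i → trans (length-starProduct i _ (A i) (A′ (K ∸ i)))
      (sym (cong₂ _*_ (Unique⇒∣∣≡length _ (Unique-A i)) (Unique⇒∣∣≡length _ (Unique-A′ (K ∸ i)))))) indices))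

  decomposition⊆ : ∀ {z} → z ∈ decomposition → z ∈ filterᵇ (not ∘ notInXU) (A′ K)
  decomposition⊆ {z} m with ∈-concatMap⁻ (λ i → starAA′ i (K ∸ i)) indices m
  ... | i , i∈ , zi with ∈indices⁻ i∈
  ...   | i1 , ile with ∈starAA′⁻ i (K ∸ i) i1 zi
  ...     | zA , zX = ∈-filterᵇ⁺ (not ∘ notInXU) (A′ K) (subst (λ w → z ∈ A′ w) (i+[K∸i]≡K i ile) zA)
    (trans (not-involutive _) (∈⇒memb z _ (X⊆XU (suc k′) i _ i1 ile (subst (λ w → z ∈ X i (2 * w + 2)) (i+[K∸i]≡K i ile) zX))))

  ⊆decomposition : ∀ {z} → z ∈ filterᵇ (not ∘ notInXU) (A′ K) → z ∈ decomposition
  ⊆decomposition {z} m with ∈-filterᵇ⁻ (not ∘ notInXU) (A′ K) m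
  ... | zA , pz with XU⊆X (suc k′) _ (memb⇒∈ z _ (trans (sym (not-involutive _)) pz))
  ...   | i , i1 , ile , zX = ∈-concatMap⁺ (λ i → starAA′ i (K ∸ i)) indices (∈indices⁺ i1 ile)
    (∈starAA′⁺ i (K ∸ i) i1 (subst (λ w → z ∈ A′ w) (sym (i+[K∸i]≡K i ile)) zA)
                            (subst (λ w → z ∈ X i (2 * w + 2)) (sym (i+[K∸i]≡K i ile)) zX))

  starAA′-disjoint : ∀ {z} i i′ → i ∈ indices → i′ ∈ indices → i < i′ →
                     z ∈ starAA′ i (K ∸ i) → z ∈ starAA′ i′ (K ∸ i′) → ⊥
  starAA′-disjoint {z} i i′ i∈ i′∈ i<i′ z∈ z∈′ =
    let (α , β , α∈ , β∈ , e) = ∈starProduct⁻ {i} {as = A i} z∈₁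
        (α′ , β′ , α′∈ , β′∈ , e′) = ∈starProduct⁻ {i + d} {as = A (i + d)} z∈₂
    in A-X-disjoint i d c′ (proj₁ (∈indices⁻ i∈)) (m<n⇒0<n∸m i<i′) α∈ β∈ α′∈ β′∈ (trans (sym e) e′)
    where
    d = i′ ∸ i
    c′ = K ∸ i′
    i+d≡i′ : i + d ≡ i′
    i+d≡i′ = m+[n∸m]≡n (<⇒≤ i<i′)
    i+[c′+d]≡K : i + (c′ + d) ≡ K
    i+[c′+d]≡K = trans (lem i d c′) (trans (cong (_+ c′) i+d≡i′) (i+[K∸i]≡K i′ (proj₂ (∈indices⁻ i′∈))))
      where lem : ∀ i d c → i + (c + d) ≡ i + d + c
            lem = solve-∀
    z∈₁ : z ∈ starAA′ i (c′ + d)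
    z∈₁ = subst (λ w → z ∈ starAA′ i w) (trans (cong (_∸ i) (sym i+[c′+d]≡K)) (m+n∸m≡n i (c′ + d))) z∈
    z∈₂ : z ∈ starAA′ (i + d) c′
    z∈₂ = subst (λ w → z ∈ starAA′ w c′) (sym i+d≡i′) z∈′

  Unique-decomposition : Unique decomposition
  Unique-decomposition = Unique-concatMap (λ i → starAA′ i (K ∸ i)) indices (UP.map⁺ suc-injective (UP.upTo⁺ (suc k′)))
    (λ {i} i∈ → Unique-starProduct (∈A⇒InA′ (proj₁ (∈indices⁻ i∈))) (λ β∈ → InA′⇒Cycle132 {K ∸ i} (∈A′⇒InA′ β∈))
                                   (Unique-A i) (Unique-A′ (K ∸ i)))
    same-index
    where
    same-index : ∀ {i i′ z} → i ∈ indices → i′ ∈ indices → z ∈ starAA′ i (K ∸ i) → z ∈ starAA′ i′ (K ∸ i′) → i ≡ i′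
    same-index {i} {i′} i∈ i′∈ z∈ z∈′ with <-cmp i i′
    ... | tri≈ _ e _ = e
    ... | tri< lt _ _ = ⊥-elim (starAA′-disjoint i i′ i∈ i′∈ lt z∈ z∈′)
    ... | tri> _ _ gt = ⊥-elim (starAA′-disjoint i′ i i′∈ i∈ gt z∈′ z∈)

  A-recurrence′ : ∣ A K ∣ + sum (map (λ i → ∣ A i ∣ * ∣ A′ (K ∸ i) ∣) indices) ≡ ∣ A′ K ∣
  A-recurrence′ = begin
    ∣ A K ∣ + sum (map (λ i → ∣ A i ∣ * ∣ A′ (K ∸ i) ∣) indices)
      ≡⟨ cong₂ _+_ (Unique⇒∣∣≡length _ (Unique-A K)) (sym length-decomposition) ⟩
    length (A K) + length decomposition
      ≡⟨ cong (length (A K) +_) (Unique-length-≡ _ _ Unique-decomposition (UP.filter⁺ _ (Unique-A′ K)) decomposition⊆ ⊆decomposition) ⟩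
    length (A K) + length (filterᵇ (not ∘ notInXU) (A′ K))
      ≡⟨ sym (length-filterᵇ-not notInXU (A′ K)) ⟩
    length (A′ K)
      ≡⟨ sym (Unique⇒∣∣≡length _ (Unique-A′ K)) ⟩
    ∣ A′ K ∣ ∎
    where open ≡-Reasoning

A-recurrence : ∀ k → 1 ≤ k → ∣ A k ∣ + sum (map (λ i → ∣ A i ∣ * ∣ A′ (k ∸ i) ∣) (map suc (upTo (k ∸ 1)))) ≡ ∣ A′ k ∣
A-recurrence (suc zero)     _ = refl
A-recurrence (suc (suc k′)) _ = Recurrence.A-recurrence′ k′

lemma6p4 : ∀ (k : ℕ) → 1 ≤ k →
    (∀ (n : ℕ) → 2 * k + 2 ≤ n → ∣ X k n ∣ ≡ ∣ A k ∣ * c (n ∸ 2 * k))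
    × (∣ A k ∣ + sum (map (λ i → ∣ A i ∣ * ∣ A′ (k ∸ i) ∣) (map suc (upTo (k ∸ 1)))) ≡ ∣ A′ k ∣)
lemma6p4 k k1 = ∣X∣≡∣A∣*c k k1 , A-recurrence k k1
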